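{- For all positive integers $n$, a red-blue $K_n$ has at most $\frac{27}{512}n^4+O(n^3)$ $RRRB$-cycles. Furthermore, for all $0<\delta<10^{ -6}$ there exists $n_0$ such that whenever $n\ge n_0$ and $G$ is a red-blue $K_n$ with more than $\frac{27}{512}n^4-\delta n^4$ $RRRB$-cycles, the red graph $R$ of $G$ has density $\sigma\in\left[\frac34-4\delta^{1/4},\frac34+4\delta^{1/4}\right]$ and is $(4\delta^{1/8})$-quasirandom of density $\sigma$.
   Context: A red-blue $K_n$ is a complete graph on $n$ vertices each of whose edges is coloured red or blue; its red graph $R$ is the spanning graph formed by the red edges. An $RRRB$-cycle is a $4$-cycle (counted as a subgraph) with exactly three red edges and one blue edge. An $n$-vertex graph $J$ has density $\sigma=e(J)/\binom n2$. For $\varepsilon>0$, an $n$-vertex graph $J$ of density $\sigma$ is $\varepsilon$-quasirandom if $\sum_{x,y\in V(J),\,x\neq y}\left||N_J(x)\cap N_J(y)|-\sigma^2 n\right|<\varepsilon n^3$ (sum over ordered pairs).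
   Formalization: The parameter δ in the stability part takes only rational values in $0<\delta<10^{ -6}$. -}

module Defs where

open import Data.Bool using (Bool; true; false; if_then_else_; _∧_; _∨_; not)
open import Data.Nat using (ℕ; zero; suc)
import Data.Nat as ℕ
open import Data.Fin using (Fin; zero; suc; _≟_)
open import Data.Product using (Σ; _×_; _,_)
open import Data.Sum using (_⊎_)
open import Data.Integer using (+_)
open import Data.Rational using (ℚ; 0ℚ; 1ℚ; _+_; _*_; _-_; _/_; ∣_∣; _≤_; _<_)
open import Relation.Nullary.Decidable using (⌊_⌋)
open import Relation.Binary.PropositionalEquality using (_≡_)

-- A red-blue K_n: colour c i j of the edge ij (true = red, false = blue).
-- Symmetric; the diagonal values c i i are meaningless and never used.
RedBlueK : ℕ → Set
RedBlueK n = Σ (Fin n → Fin n → Bool) (λ c → ∀ i j → c i j ≡ c j i)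

sumFin : (n : ℕ) → (Fin n → ℕ) → ℕ
sumFin zero    f = 0
sumFin (suc n) f = f zero ℕ.+ sumFin n (λ i → f (suc i))

sumFinℚ : (n : ℕ) → (Fin n → ℚ) → ℚ
sumFinℚ zero    f = 0ℚ
sumFinℚ (suc n) f = f zero + sumFinℚ n (λ i → f (suc i))

countFin : (n : ℕ) → (Fin n → Bool) → ℕ
countFin n p = sumFin n (λ i → if p i then 1 else 0)

neq : ∀ {n} → Fin n → Fin n → Bool
neq a b = not ⌊ a ≟ b ⌋

distinct4 : ∀ {n} → Fin n → Fin n → Fin n → Fin n → Bool
distinct4 a b c d =
  neq a b ∧ neq a c ∧ neq a d ∧ neq b c ∧ neq b d ∧ neq c d

exactlyOneFalse : Bool → Bool → Bool → Bool → Bool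
exactlyOneFalse a b c d =
  (not a ∧ b ∧ c ∧ d) ∨ (a ∧ not b ∧ c ∧ d) ∨ (a ∧ b ∧ not c ∧ d) ∨ (a ∧ b ∧ c ∧ not d)

rrrbTuples : ∀ {n} → RedBlueK n → ℕ
rrrbTuples {n} (col , _) =
  sumFin n λ a → sumFin n λ b → sumFin n λ c → countFin n λ d →
    distinct4 a b c d ∧ exactlyOneFalse (col a b) (col b c) (col c d) (col d a)

-- Number of RRRB-cycles (4-cycles as subgraphs): every 4-cycle corresponds
-- to exactly 8 ordered tuples (4 starting points × 2 directions).
rrrb : ∀ {n} → RedBlueK n → ℕ
rrrb G = rrrbTuples G ℕ./ 8

-- number of ordered pairs (x,y), x ≠ y, with xy red  (= 2 e(R))
redOrdered : ∀ {n} → RedBlueK n → ℕ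
redOrdered {n} (col , _) = sumFin n λ x → countFin n λ y → neq x y ∧ col x y

-- density σ = e(R) / (n choose 2) = 2e(R) / (n(n-1));
-- (convention: 0 when n ≤ 1, where the density is undefined)
density : ∀ {n} → RedBlueK n → ℚ
density {n} G with n ℕ.* (n ℕ.∸ 1)
... | zero  = 0ℚ
... | suc k = + redOrdered G / suc k

codeg : ∀ {n} → RedBlueK n → Fin n → Fin n → ℕ
codeg {n} (col , _) x y =
  countFin n λ z → neq z x ∧ neq z y ∧ col x z ∧ col y z

ℕtoℚ : ℕ → ℚ
ℕtoℚ m = + m / 1

qrSum : ∀ {n} → RedBlueK n → ℚ
qrSum {n} G =
  sumFinℚ n λ x → sumFinℚ n λ y →
    if neq x y then ∣ ℕtoℚ (codeg G x y) - density G * density G * ℕtoℚ n ∣ else 0ℚ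

pow : ℚ → ℕ → ℚ
pow q zero    = 1ℚ
pow q (suc k) = q * pow q k

-- Real comparisons against c·δ^(1/k) with c ≥ 0, δ > 0, k ≥ 1, expressed
-- without real roots:  x < c·δ^(1/k)  iff  x < 0, or 0 ≤ x and x^k < c^k δ.
LtRoot : ℚ → ℚ → ℕ → ℚ → Set
LtRoot x c k δ = x < 0ℚ ⊎ (0ℚ ≤ x × pow x k < pow c k * δ)

--  x ≤ c·δ^(1/k)  iff  x < 0, or 0 ≤ x and x^k ≤ c^k δ.
LeRoot : ℚ → ℚ → ℕ → ℚ → Set
LeRoot x c k δ = x < 0ℚ ⊎ (0ℚ ≤ x × pow x k ≤ pow c k * δ)

-- Average over the vertices and let A be the 0/1 matrix of red edges. With the normalised degrees
-- d_i = 𝔼_j A_ij, codegrees c_ij = 𝔼_z A_iz A_zj and d₂ = A d, put s = 𝔼 d, p = 𝔼 d², q = 𝔼 d₂²,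
-- x = 𝔼 d d₂ (red 3-walks) and f = 𝔼 c² (red 4-cycles). An RRRB 4-tuple is, in one of its four
-- rotations, a red 3-path whose closing edge is blue, so there are at most 4n⁴(x - f) of them.
-- Cauchy–Schwarz gives x² ≤ pq and p² ≤ q ≤ f, and a sum-of-squares certificate turns x² ≤ pf,
-- p² ≤ f into x ≤ f + 27/256, whence 512·rrrb ≤ 27n⁴. Within δn⁴ of this bound the same certificate
-- forces (p - 9/16)² = O(δ) and f - p² = O(δ). Then s, and with it σ = sn/(n - 1), is within
-- O(δ^½) of 3/4, and 𝔼|c_ij - σ²| ≤ (f - p²)^½ + |p - σ²| = O(δ^½), which is quasirandomness.

module Submission where

open import Data.Bool using (Bool; true; false; _∧_; not; T; if_then_else_)
open import Data.Bool.Properties using (T-∧; ∧-commutativeMonoid)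
open import Algebra.Solver.CommutativeMonoid ∧-commutativeMonoid using (solve; _⊕_; _⊜_)
open import Data.Fin using (Fin; zero; suc)
import Data.Fin as Fin
open import Data.Integer as ℤ using (+_; -[1+_])
import Data.Integer.Properties as ℤₚ
open import Data.List using (_∷_; [])
open import Data.Maybe using (Maybe; just; nothing)
open import Data.Nat as ℕ using (ℕ; zero; suc; _≥_)
open import Data.Nat.Coprimality using (1-coprimeTo)
import Data.Nat.Coprimality as Coprime
open import Data.Nat.DivMod using (m/n*n≤m)
import Data.Nat.Properties as ℕₚ
open import Data.Product using (Σ; _×_; _,_; proj₁; proj₂)
open import Data.Rational hiding (_≥_)
open import Data.Rational.Properties
import Data.Rational.Unnormalised as ℚᵘ
import Data.Rational.Unnormalised.Properties as ℚᵘₚ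
open import Data.Sum using (inj₁; inj₂; [_,_]′)
open import Function.Bundles using (Equivalence)
open import Relation.Binary.PropositionalEquality
open import Relation.Nullary using (yes; no; contradiction)
open import Relation.Nullary.Decidable using (True; toWitness)
open import Tactic.RingSolver using (solve-∀) renaming (solve to ring-solve)
open import Tactic.RingSolver.Core.AlmostCommutativeRing using (AlmostCommutativeRing; fromCommutativeRing)
open import Defs

-- Boolean indicators

⟦_⟧ : Bool → ℕ
⟦ b ⟧ = if b then 1 else 0

BoolFun : ℕ → Set
BoolFun zero    = Bool
BoolFun (suc m) = Bool → BoolFun m

Valid : ∀ m → BoolFun m → Set
Valid zero    b = T b
Valid (suc m) φ = ∀ b → Valid m (φ b)

valid? : ∀ m → BoolFun m → Bool
valid? zero    b = b
valid? (suc m) φ = valid? m (φ true) ∧ valid? m (φ false)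

valid?-sound : ∀ m (φ : BoolFun m) → T (valid? m φ) → Valid m φ
valid?-sound zero    b h = h
valid?-sound (suc m) φ h true  = valid?-sound m (φ true)  (proj₁ (Equivalence.to T-∧ h))
valid?-sound (suc m) φ h false = valid?-sound m (φ false) (proj₂ (Equivalence.to T-∧ h))

∧-rearrange : ∀ x₁ x₂ x₃ x₄ x₅ x₆ →
  x₄ ∧ x₅ ∧ x₁ ∧ x₆ ∧ x₂ ∧ x₃ ≡ x₁ ∧ x₂ ∧ x₃ ∧ x₄ ∧ x₅ ∧ x₆
∧-rearrange = solve 6
  (λ x₁ x₂ x₃ x₄ x₅ x₆ → x₄ ⊕ x₅ ⊕ x₁ ⊕ x₆ ⊕ x₂ ⊕ x₃ ⊜ x₁ ⊕ x₂ ⊕ x₃ ⊕ x₄ ⊕ x₅ ⊕ x₆) refl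

∧-interchange : ∀ a b c d → a ∧ b ∧ c ∧ d ≡ (a ∧ c) ∧ (b ∧ d)
∧-interchange = solve 4 (λ a b c d → a ⊕ b ⊕ c ⊕ d ⊜ (a ⊕ c) ⊕ (b ⊕ d)) refl

⟦∧⟧ : ∀ a b → ⟦ a ∧ b ⟧ ≡ ⟦ a ⟧ ℕ.* ⟦ b ⟧
⟦∧⟧ false b = refl
⟦∧⟧ true  b = sym (ℕₚ.*-identityˡ ⟦ b ⟧)

⟦⟧≤1 : ∀ b → ⟦ b ⟧ ℕ.≤ 1
⟦⟧≤1 true  = ℕ.s≤s ℕ.z≤n
⟦⟧≤1 false = ℕ.z≤n

⟦exactlyOneFalse⟧≤ : ∀ D e₁ e₂ e₃ e₄ →
  ⟦ D ∧ exactlyOneFalse e₁ e₂ e₃ e₄ ⟧ ℕ.≤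
    ⟦ D ∧ e₂ ∧ e₃ ∧ e₄ ∧ not e₁ ⟧ ℕ.+ ⟦ D ∧ e₃ ∧ e₄ ∧ e₁ ∧ not e₂ ⟧
    ℕ.+ ⟦ D ∧ e₄ ∧ e₁ ∧ e₂ ∧ not e₃ ⟧ ℕ.+ ⟦ D ∧ e₁ ∧ e₂ ∧ e₃ ∧ not e₄ ⟧
⟦exactlyOneFalse⟧≤ D e₁ e₂ e₃ e₄ = ℕₚ.≤ᵇ⇒≤ _ _ (valid?-sound 5
  (λ D e₁ e₂ e₃ e₄ → ⟦ D ∧ exactlyOneFalse e₁ e₂ e₃ e₄ ⟧ ℕ.≤ᵇ
    (⟦ D ∧ e₂ ∧ e₃ ∧ e₄ ∧ not e₁ ⟧ ℕ.+ ⟦ D ∧ e₃ ∧ e₄ ∧ e₁ ∧ not e₂ ⟧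
     ℕ.+ ⟦ D ∧ e₄ ∧ e₁ ∧ e₂ ∧ not e₃ ⟧ ℕ.+ ⟦ D ∧ e₁ ∧ e₂ ∧ e₃ ∧ not e₄ ⟧))
  _ D e₁ e₂ e₃ e₄)

-- The two events on the left disagree on the colour of da, and each contains the red path abcd.
⟦open-path⟧+⟦closed-walk⟧≤⟦path⟧ : ∀ nab nac nad nbc nbd ncd nda cab cbc ccd cda →
  ⟦ (nab ∧ nac ∧ nad ∧ nbc ∧ nbd ∧ ncd) ∧ cab ∧ cbc ∧ ccd ∧ not cda ⟧
    ℕ.+ ⟦ nab ∧ cab ⟧ ℕ.* ⟦ nbc ∧ cbc ⟧ ℕ.* ⟦ ncd ∧ ccd ⟧ ℕ.* ⟦ nda ∧ cda ⟧
  ℕ.≤ ⟦ nab ∧ cab ⟧ ℕ.* ⟦ nbc ∧ cbc ⟧ ℕ.* ⟦ ncd ∧ ccd ⟧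
⟦open-path⟧+⟦closed-walk⟧≤⟦path⟧ nab nac nad nbc nbd ncd nda cab cbc ccd cda = ℕₚ.≤ᵇ⇒≤ _ _ (valid?-sound 11
  (λ nab nac nad nbc nbd ncd nda cab cbc ccd cda →
    (⟦ (nab ∧ nac ∧ nad ∧ nbc ∧ nbd ∧ ncd) ∧ cab ∧ cbc ∧ ccd ∧ not cda ⟧
      ℕ.+ ⟦ nab ∧ cab ⟧ ℕ.* ⟦ nbc ∧ cbc ⟧ ℕ.* ⟦ ncd ∧ ccd ⟧ ℕ.* ⟦ nda ∧ cda ⟧)
    ℕ.≤ᵇ ⟦ nab ∧ cab ⟧ ℕ.* ⟦ nbc ∧ cbc ⟧ ℕ.* ⟦ ncd ∧ ccd ⟧)
  _ nab nac nad nbc nbd ncd nda cab cbc ccd cda)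

-- Rational arithmetic

ℚ-ring : AlmostCommutativeRing _ _
ℚ-ring = fromCommutativeRing +-*-commutativeRing isZero
  where
  isZero : ∀ p → Maybe (0ℚ ≡ p)
  isZero p with 0ℚ ≟ p
  ... | yes 0≡p = just 0≡p
  ... | no  _   = nothing

0≤q-p⇒p≤q : ∀ {p q} → 0ℚ ≤ q - p → p ≤ q
0≤q-p⇒p≤q {p} {q} h = begin
  p           ≡⟨ ring-solve (p ∷ []) ℚ-ring ⟩
  p + 0ℚ      ≤⟨ +-monoʳ-≤ p h ⟩
  p + (q - p) ≡⟨ ring-solve (p ∷ q ∷ []) ℚ-ring ⟩
  q           ∎
  where open ≤-Reasoning

p≤q⇒0≤q-p : ∀ {p q} → p ≤ q → 0ℚ ≤ q - p
p≤q⇒0≤q-p {p} {q} h = begin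
  0ℚ    ≡⟨ ring-solve (p ∷ []) ℚ-ring ⟩
  p - p ≤⟨ +-monoˡ-≤ (- p) h ⟩
  q - p ∎
  where open ≤-Reasoning

p<q⇒0<q-p : ∀ {p q} → p < q → 0ℚ < q - p
p<q⇒0<q-p {p} {q} h = begin-strict
  0ℚ    ≡⟨ ring-solve (p ∷ []) ℚ-ring ⟩
  p - p <⟨ +-monoˡ-< (- p) h ⟩
  q - p ∎
  where open ≤-Reasoning

≤-byDifference : ∀ {p q} r → q - p ≡ r → 0ℚ ≤ r → p ≤ q
≤-byDifference r q-p≡r 0≤r = 0≤q-p⇒p≤q (subst (0ℚ ≤_) (sym q-p≡r) 0≤r)

nonNeg-+ : ∀ {p q} → 0ℚ ≤ p → 0ℚ ≤ q → 0ℚ ≤ p + q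
nonNeg-+ = +-mono-≤

nonNeg-* : ∀ {p q} → 0ℚ ≤ p → 0ℚ ≤ q → 0ℚ ≤ p * q
nonNeg-* {p} {q} 0≤p 0≤q = nonNegative⁻¹ _ {{nonNeg*nonNeg⇒nonNeg p {{nonNegative 0≤p}} q {{nonNegative 0≤q}}}}

pos-* : ∀ {p q} → 0ℚ < p → 0ℚ < q → 0ℚ < p * q
pos-* {p} {q} 0<p 0<q = positive⁻¹ _ {{pos*pos⇒pos p {{positive 0<p}} q {{positive 0<q}}}}

nonNeg-sq : ∀ p → 0ℚ ≤ p * p
nonNeg-sq p with ≤-total 0ℚ p
... | inj₁ 0≤p = nonNeg-* 0≤p 0≤p
... | inj₂ p≤0 = nonNegative⁻¹ _ {{nonPos*nonPos⇒nonPos p {{nonPositive p≤0}} p {{nonPositive p≤0}}}}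

*-monoˡ-≤ : ∀ {p q} r → 0ℚ ≤ r → p ≤ q → r * p ≤ r * q
*-monoˡ-≤ r 0≤r = *-monoˡ-≤-nonNeg r {{nonNegative 0≤r}}

*-monoʳ-≤ : ∀ {p q} r → 0ℚ ≤ r → p ≤ q → p * r ≤ q * r
*-monoʳ-≤ r 0≤r = *-monoʳ-≤-nonNeg r {{nonNegative 0≤r}}

*-mono-≤ : ∀ {p q r s} → 0ℚ ≤ p → 0ℚ ≤ r → p ≤ q → r ≤ s → p * r ≤ q * s
*-mono-≤ {q = q} {r} 0≤p 0≤r p≤q r≤s = ≤-trans (*-monoʳ-≤ r 0≤r p≤q) (*-monoˡ-≤ q (≤-trans 0≤p p≤q) r≤s)

sq-mono-≤ : ∀ {p q} → 0ℚ ≤ p → p ≤ q → p * p ≤ q * q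
sq-mono-≤ 0≤p p≤q = *-mono-≤ 0≤p 0≤p p≤q p≤q

sq-cancel-≤ : ∀ {p q} → 0ℚ ≤ q → p * p ≤ q * q → p ≤ q
sq-cancel-≤ {p} {q} 0≤q p²≤q² with p ≤? q
... | yes p≤q = p≤q
... | no  p≰q = contradiction (≤-<-trans p²≤q² q²<p²) (<-irrefl refl)
  where
  q<p : q < p
  q<p = ≰⇒> p≰q
  q²<p² : q * q < p * p
  q²<p² = ≤-<-trans (*-monoˡ-≤ q 0≤q (<⇒≤ q<p))
                    (*-monoˡ-<-pos p {{positive (≤-<-trans 0≤q q<p)}} q<p)

p≤∣p∣ : ∀ p → p ≤ ∣ p ∣
p≤∣p∣ p with ≤-total 0ℚ p
... | inj₁ 0≤p = ≤-reflexive (sym (0≤p⇒∣p∣≡p 0≤p))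
... | inj₂ p≤0 = ≤-trans p≤0 (0≤∣p∣ p)

p≤p+q : ∀ {p q} → 0ℚ ≤ q → p ≤ p + q
p≤p+q {p} {q} 0≤q = ≤-byDifference q (ring-solve (p ∷ q ∷ []) ℚ-ring) 0≤q

q≤p+q : ∀ {p q} → 0ℚ ≤ p → q ≤ p + q
q≤p+q {p} {q} 0≤p = ≤-byDifference p (ring-solve (p ∷ q ∷ []) ℚ-ring) 0≤p

-p≤∣p∣ : ∀ p → - p ≤ ∣ p ∣
-p≤∣p∣ p = subst (- p ≤_) (∣-p∣≡∣p∣ p) (p≤∣p∣ (- p))

_∈[0,1] : ℚ → Set
r ∈[0,1] = 0ℚ ≤ r × r ≤ 1ℚ

∈[0,1]-* : ∀ {p q} → p ∈[0,1] → q ∈[0,1] → (p * q) ∈[0,1]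
∈[0,1]-* (0≤p , p≤1) (0≤q , q≤1) = nonNeg-* 0≤p 0≤q , *-mono-≤ 0≤p 0≤q p≤1 q≤1

∈[0,1]-sq : ∀ {p} → p ∈[0,1] → (p * p) ∈[0,1]
∈[0,1]-sq p∈ = ∈[0,1]-* p∈ p∈

0≤∣p∣-p : ∀ p → 0ℚ ≤ ∣ p ∣ - p
0≤∣p∣-p p = p≤q⇒0≤q-p (p≤∣p∣ p)

0≤∣p∣+p : ∀ p → 0ℚ ≤ ∣ p ∣ + p
0≤∣p∣+p p = subst (0ℚ ≤_) (minus-neg ∣ p ∣ p) (p≤q⇒0≤q-p (-p≤∣p∣ p))
  where
  minus-neg : ∀ a b → a - (- b) ≡ a + b
  minus-neg = solve-∀ ℚ-ring

∣p∣*∣p∣≡p*p : ∀ p → ∣ p ∣ * ∣ p ∣ ≡ p * p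
∣p∣*∣p∣≡p*p p = trans (sym (∣p*q∣≡∣p∣*∣q∣ p p)) (0≤p⇒∣p∣≡p (nonNeg-sq p))

≤-byComputation : ∀ p q {_ : T (p ≤ᵇ q)} → p ≤ q
≤-byComputation p q {p≤ᵇq} = ≤ᵇ⇒≤ p≤ᵇq

nonNeg-byComputation : ∀ r {_ : T (0ℚ ≤ᵇ r)} → 0ℚ ≤ r
nonNeg-byComputation r {0≤ᵇr} = ≤ᵇ⇒≤ 0≤ᵇr

<-byComputation : ∀ p q {_ : True (p <? q)} → p < q
<-byComputation p q {p<?q} = toWitness p<?q

pow-nonNeg : ∀ {p} m → 0ℚ ≤ p → 0ℚ ≤ pow p m
pow-nonNeg zero    0≤p = nonNeg-byComputation 1ℚ
pow-nonNeg (suc m) 0≤p = nonNeg-* 0≤p (pow-nonNeg m 0≤p)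

pow-pos : ∀ {p} m → 0ℚ < p → 0ℚ < pow p m
pow-pos zero    0<p = <-byComputation 0ℚ 1ℚ
pow-pos (suc m) 0<p = pos-* 0<p (pow-pos m 0<p)

pow-mono-≤ : ∀ {p q} m → 0ℚ ≤ p → p ≤ q → pow p m ≤ pow q m
pow-mono-≤ zero    0≤p p≤q = ≤-refl
pow-mono-≤ (suc m) 0≤p p≤q = *-mono-≤ 0≤p (pow-nonNeg m 0≤p) p≤q (pow-mono-≤ m 0≤p p≤q)

pow-*-distrib : ∀ p q m → pow (p * q) m ≡ pow p m * pow q m
pow-*-distrib p q zero    = refl
pow-*-distrib p q (suc m) = trans (cong ((p * q) *_) (pow-*-distrib p q m)) (interchange p q (pow p m) (pow q m))
  where
  interchange : ∀ a b c d → (a * b) * (c * d) ≡ (a * c) * (b * d)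
  interchange = solve-∀ ℚ-ring

-- Natural numbers as rationals

private
  ℕtoℚ′ : ℕ → ℚ
  ℕtoℚ′ m = mkℚ (+ m) 0 (Coprime.sym (1-coprimeTo m))

  1/suc′ : ℕ → ℚ
  1/suc′ k = mkℚ (+ 1) k (1-coprimeTo (suc k))

ℕtoℚ≡mkℚ : ∀ m → ℕtoℚ m ≡ ℕtoℚ′ m
ℕtoℚ≡mkℚ m = ↥p/↧p≡p (ℕtoℚ′ m)

ℕtoℚ-+ : ∀ a b → ℕtoℚ (a ℕ.+ b) ≡ ℕtoℚ a + ℕtoℚ b
ℕtoℚ-+ a b rewrite ℕtoℚ≡mkℚ (a ℕ.+ b) | ℕtoℚ≡mkℚ a | ℕtoℚ≡mkℚ b =
  toℚᵘ-injective (ℚᵘₚ.≃-trans (ℚᵘ.*≡* numerators) (ℚᵘₚ.≃-sym (toℚᵘ-homo-+ (ℕtoℚ′ a) (ℕtoℚ′ b))))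
  where
  numerators : + (a ℕ.+ b) ℤ.* + 1 ≡ (+ a ℤ.* + 1 ℤ.+ + b ℤ.* + 1) ℤ.* + 1
  numerators rewrite ℤₚ.*-identityʳ (+ (a ℕ.+ b)) | ℤₚ.*-identityʳ (+ a) | ℤₚ.*-identityʳ (+ b)
                   | ℤₚ.*-identityʳ (+ a ℤ.+ + b) = ℤₚ.pos-+ a b

ℕtoℚ-* : ∀ a b → ℕtoℚ (a ℕ.* b) ≡ ℕtoℚ a * ℕtoℚ b
ℕtoℚ-* a b rewrite ℕtoℚ≡mkℚ (a ℕ.* b) | ℕtoℚ≡mkℚ a | ℕtoℚ≡mkℚ b =
  toℚᵘ-injective (ℚᵘₚ.≃-trans (ℚᵘ.*≡* numerators) (ℚᵘₚ.≃-sym (toℚᵘ-homo-* (ℕtoℚ′ a) (ℕtoℚ′ b))))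
  where
  numerators : + (a ℕ.* b) ℤ.* + 1 ≡ (+ a ℤ.* + b) ℤ.* + 1
  numerators rewrite ℤₚ.*-identityʳ (+ (a ℕ.* b)) | ℤₚ.*-identityʳ (+ a ℤ.* + b) = ℤₚ.pos-* a b

ℕtoℚ-^ : ∀ a m → ℕtoℚ (a ℕ.^ m) ≡ pow (ℕtoℚ a) m
ℕtoℚ-^ a zero    = refl
ℕtoℚ-^ a (suc m) = trans (ℕtoℚ-* a (a ℕ.^ m)) (cong (ℕtoℚ a *_) (ℕtoℚ-^ a m))

ℕtoℚ-mono-≤ : ∀ {a b} → a ℕ.≤ b → ℕtoℚ a ≤ ℕtoℚ b
ℕtoℚ-mono-≤ {a} {b} a≤b rewrite ℕtoℚ≡mkℚ a | ℕtoℚ≡mkℚ b =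
  *≤* (subst₂ ℤ._≤_ (sym (ℤₚ.*-identityʳ (+ a))) (sym (ℤₚ.*-identityʳ (+ b))) (ℤ.+≤+ a≤b))

ℕtoℚ-cancel-≤ : ∀ {a b} → ℕtoℚ a ≤ ℕtoℚ b → a ℕ.≤ b
ℕtoℚ-cancel-≤ {a} {b} h rewrite ℕtoℚ≡mkℚ a | ℕtoℚ≡mkℚ b with drop-*≤* h
... | a*1≤b*1 rewrite ℤₚ.*-identityʳ (+ a) | ℤₚ.*-identityʳ (+ b) = ℤₚ.drop‿+≤+ a*1≤b*1

0≤ℕtoℚ : ∀ a → 0ℚ ≤ ℕtoℚ a
0≤ℕtoℚ a = ℕtoℚ-mono-≤ {0} {a} ℕ.z≤n

1/suc : ℕ → ℚ
1/suc k = + 1 / suc k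

1/suc≡mkℚ : ∀ k → 1/suc k ≡ 1/suc′ k
1/suc≡mkℚ k = ↥p/↧p≡p (1/suc′ k)

1/suc-inverseˡ : ∀ k → 1/suc k * ℕtoℚ (suc k) ≡ 1ℚ
1/suc-inverseˡ k rewrite 1/suc≡mkℚ k | ℕtoℚ≡mkℚ (suc k) =
  toℚᵘ-injective (ℚᵘₚ.≃-trans (toℚᵘ-homo-* (1/suc′ k) (ℕtoℚ′ (suc k))) (ℚᵘ.*≡* numerators))
  where
  numerators : (+ 1 ℤ.* + suc k) ℤ.* + 1 ≡ + 1 ℤ.* (+ (suc k ℕ.* 1))
  numerators rewrite ℤₚ.*-identityʳ (+ 1 ℤ.* + suc k) | ℤₚ.*-identityˡ (+ suc k)
                   | ℤₚ.*-identityˡ (+ (suc k ℕ.* 1)) = cong +_ (sym (ℕₚ.*-identityʳ (suc k)))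

0≤1/suc : ∀ k → 0ℚ ≤ 1/suc k
0≤1/suc k rewrite 1/suc≡mkℚ k = *≤* (ℤ.+≤+ ℕ.z≤n)

/suc≡*1/suc : ∀ a k → + a / suc k ≡ ℕtoℚ a * 1/suc k
/suc≡*1/suc a k rewrite ℕtoℚ≡mkℚ a | 1/suc≡mkℚ k =
  toℚᵘ-injective (ℚᵘₚ.≃-trans (toℚᵘ-fromℚᵘ (ℚᵘ.mkℚᵘ (+ a) k))
    (ℚᵘₚ.≃-trans (ℚᵘ.*≡* numerators) (ℚᵘₚ.≃-sym (toℚᵘ-homo-* (ℕtoℚ′ a) (1/suc′ k)))))
  where
  numerators : + a ℤ.* (+ (1 ℕ.* suc k)) ≡ (+ a ℤ.* + 1) ℤ.* + suc k
  numerators rewrite ℕₚ.*-identityˡ (suc k) | ℤₚ.*-identityʳ (+ a) = refl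

1≤↧δ*δ : ∀ δ → 0ℚ < δ → 1ℚ ≤ ℕtoℚ (↧ₙ δ) * δ
1≤↧δ*δ (mkℚ (+ zero)  d c) (*<* (ℤ.+<+ ()))
1≤↧δ*δ (mkℚ -[1+ a ] d c) (*<* ())
1≤↧δ*δ δ@(mkℚ (+ suc a) d c) _ rewrite ℕtoℚ≡mkℚ (suc d) =
  toℚᵘ-cancel-≤ (ℚᵘₚ.≤-respʳ-≃ (ℚᵘₚ.≃-sym (toℚᵘ-homo-* (ℕtoℚ′ (suc d)) δ)) (ℚᵘ.*≤* (ℤ.+≤+ d<d*a)))
  where
  d<d*a : suc ((d ℕ.+ 0) ℕ.+ 0) ℕ.≤ (suc d ℕ.* suc a) ℕ.* 1
  d<d*a rewrite ℕₚ.+-identityʳ d | ℕₚ.+-identityʳ d | ℕₚ.*-identityʳ (suc d ℕ.* suc a) =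
    ℕₚ.m≤m*n (suc d) (suc a)

-- Sums and averages over vertices

Σ-cong : ∀ n {f g : Fin n → ℚ} → (∀ i → f i ≡ g i) → sumFinℚ n f ≡ sumFinℚ n g
Σ-cong zero    f≗g = refl
Σ-cong (suc n) f≗g = cong₂ _+_ (f≗g zero) (Σ-cong n (λ i → f≗g (suc i)))

Σ-+ : ∀ n (f g : Fin n → ℚ) → sumFinℚ n (λ i → f i + g i) ≡ sumFinℚ n f + sumFinℚ n g
Σ-+ zero    f g = refl
Σ-+ (suc n) f g rewrite Σ-+ n (λ i → f (suc i)) (λ i → g (suc i)) =
  swap-middle (f zero) (g zero) (sumFinℚ n (λ i → f (suc i))) (sumFinℚ n (λ i → g (suc i)))
  where
  swap-middle : ∀ a b c d → a + b + (c + d) ≡ a + c + (b + d)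
  swap-middle = solve-∀ ℚ-ring

Σ-neg : ∀ n (f : Fin n → ℚ) → sumFinℚ n (λ i → - f i) ≡ - sumFinℚ n f
Σ-neg zero    f = refl
Σ-neg (suc n) f rewrite Σ-neg n (λ i → f (suc i)) = sym (neg-distrib-+ (f zero) _)

Σ-*ˡ : ∀ n r (f : Fin n → ℚ) → sumFinℚ n (λ i → r * f i) ≡ r * sumFinℚ n f
Σ-*ˡ zero    r f = sym (*-zeroʳ r)
Σ-*ˡ (suc n) r f rewrite Σ-*ˡ n r (λ i → f (suc i)) = sym (*-distribˡ-+ r (f zero) _)

Σ-const : ∀ n r → sumFinℚ n (λ _ → r) ≡ ℕtoℚ n * r
Σ-const zero    r = sym (*-zeroˡ r)
Σ-const (suc n) r rewrite Σ-const n r | ℕtoℚ-+ 1 n = distrib r (ℕtoℚ n)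
  where
  distrib : ∀ r m → r + m * r ≡ (1ℚ + m) * r
  distrib = solve-∀ ℚ-ring

Σ-mono-≤ : ∀ n {f g : Fin n → ℚ} → (∀ i → f i ≤ g i) → sumFinℚ n f ≤ sumFinℚ n g
Σ-mono-≤ zero    f≤g = ≤-refl
Σ-mono-≤ (suc n) f≤g = +-mono-≤ (f≤g zero) (Σ-mono-≤ n (λ i → f≤g (suc i)))

Σ-nonNeg : ∀ n {f : Fin n → ℚ} → (∀ i → 0ℚ ≤ f i) → 0ℚ ≤ sumFinℚ n f
Σ-nonNeg zero    0≤f = ≤-refl
Σ-nonNeg (suc n) 0≤f = nonNeg-+ (0≤f zero) (Σ-nonNeg n (λ i → 0≤f (suc i)))

Σ-swap : ∀ n m (f : Fin n → Fin m → ℚ) →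
  sumFinℚ n (λ i → sumFinℚ m (f i)) ≡ sumFinℚ m (λ j → sumFinℚ n (λ i → f i j))
Σ-swap zero    m f = sym (trans (Σ-const m 0ℚ) (*-zeroʳ (ℕtoℚ m)))
Σ-swap (suc n) m f rewrite Σ-swap n m (λ i → f (suc i)) =
  sym (Σ-+ m (f zero) (λ j → sumFinℚ n (λ i → f (suc i) j)))

ℕtoℚ-sumFin : ∀ n (f : Fin n → ℕ) → ℕtoℚ (sumFin n f) ≡ sumFinℚ n (λ i → ℕtoℚ (f i))
ℕtoℚ-sumFin zero    f = refl
ℕtoℚ-sumFin (suc n) f =
  trans (ℕtoℚ-+ (f zero) (sumFin n (λ i → f (suc i))))
        (cong (_+_ (ℕtoℚ (f zero))) (ℕtoℚ-sumFin n (λ i → f (suc i))))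

module Averages (k : ℕ) where

  private
    n : ℕ
    n = suc k

  opaque
    𝔼 : (Fin n → ℚ) → ℚ
    𝔼 f = 1/suc k * sumFinℚ n f

    Σ≡n*𝔼 : ∀ f → sumFinℚ n f ≡ ℕtoℚ n * 𝔼 f
    Σ≡n*𝔼 f = begin
      sumFinℚ n f                           ≡⟨ *-identityˡ _ ⟨
      1ℚ * sumFinℚ n f                      ≡⟨ cong (_* sumFinℚ n f) (1/suc-inverseˡ k) ⟨
      1/suc k * ℕtoℚ n * sumFinℚ n f        ≡⟨ cong (_* sumFinℚ n f) (*-comm (1/suc k) (ℕtoℚ n)) ⟩
      ℕtoℚ n * 1/suc k * sumFinℚ n f        ≡⟨ *-assoc (ℕtoℚ n) (1/suc k) (sumFinℚ n f) ⟩
      ℕtoℚ n * (1/suc k * sumFinℚ n f)      ∎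
      where open ≡-Reasoning

    𝔼-cong : ∀ {f g : Fin n → ℚ} → (∀ i → f i ≡ g i) → 𝔼 f ≡ 𝔼 g
    𝔼-cong f≗g = cong (1/suc k *_) (Σ-cong n f≗g)

    𝔼-+ : ∀ (f g : Fin n → ℚ) → 𝔼 (λ i → f i + g i) ≡ 𝔼 f + 𝔼 g
    𝔼-+ f g rewrite Σ-+ n f g = *-distribˡ-+ (1/suc k) _ _

    𝔼-minus : ∀ (f g : Fin n → ℚ) → 𝔼 (λ i → f i - g i) ≡ 𝔼 f - 𝔼 g
    𝔼-minus f g rewrite Σ-+ n f (λ i → - g i) | Σ-neg n g =
      distrib (1/suc k) (sumFinℚ n f) (sumFinℚ n g)
      where
      distrib : ∀ a b c → a * (b - c) ≡ a * b - a * c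
      distrib = solve-∀ ℚ-ring

    𝔼-*ˡ : ∀ r (f : Fin n → ℚ) → 𝔼 (λ i → r * f i) ≡ r * 𝔼 f
    𝔼-*ˡ r f rewrite Σ-*ˡ n r f = commute (1/suc k) r (sumFinℚ n f)
      where
      commute : ∀ a b c → a * (b * c) ≡ b * (a * c)
      commute = solve-∀ ℚ-ring

    𝔼-const : ∀ r → 𝔼 (λ _ → r) ≡ r
    𝔼-const r rewrite Σ-const n r =
      trans (sym (*-assoc (1/suc k) _ r)) (trans (cong (_* r) (1/suc-inverseˡ k)) (*-identityˡ r))

    𝔼-mono-≤ : ∀ {f g : Fin n → ℚ} → (∀ i → f i ≤ g i) → 𝔼 f ≤ 𝔼 g
    𝔼-mono-≤ f≤g = *-monoˡ-≤ (1/suc k) (0≤1/suc k) (Σ-mono-≤ n f≤g)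

    𝔼-nonNeg : ∀ {f : Fin n → ℚ} → (∀ i → 0ℚ ≤ f i) → 0ℚ ≤ 𝔼 f
    𝔼-nonNeg 0≤f = nonNeg-* (0≤1/suc k) (Σ-nonNeg n 0≤f)

    𝔼-swap : ∀ (f : Fin n → Fin n → ℚ) → 𝔼 (λ i → 𝔼 (f i)) ≡ 𝔼 (λ j → 𝔼 (λ i → f i j))
    𝔼-swap f = cong (1/suc k *_) (begin
      sumFinℚ n (λ i → 1/suc k * sumFinℚ n (f i))                ≡⟨ Σ-*ˡ n (1/suc k) (λ i → sumFinℚ n (f i)) ⟩
      1/suc k * sumFinℚ n (λ i → sumFinℚ n (f i))                ≡⟨ cong (1/suc k *_) (Σ-swap n n f) ⟩
      1/suc k * sumFinℚ n (λ j → sumFinℚ n (λ i → f i j))        ≡⟨ Σ-*ˡ n (1/suc k) (λ j → sumFinℚ n (λ i → f i j)) ⟨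
      sumFinℚ n (λ j → 1/suc k * sumFinℚ n (λ i → f i j))        ∎)
      where open ≡-Reasoning

  𝔼-∈[0,1] : ∀ {f : Fin n → ℚ} → (∀ i → f i ∈[0,1]) → 𝔼 f ∈[0,1]
  𝔼-∈[0,1] f∈ = 𝔼-nonNeg (λ i → proj₁ (f∈ i)) , ≤-trans (𝔼-mono-≤ (λ i → proj₂ (f∈ i))) (≤-reflexive (𝔼-const 1ℚ))

  𝔼-*ʳ : ∀ r (f : Fin n → ℚ) → 𝔼 (λ i → f i * r) ≡ 𝔼 f * r
  𝔼-*ʳ r f = trans (𝔼-cong (λ i → *-comm (f i) r)) (trans (𝔼-*ˡ r f) (*-comm r (𝔼 f)))

  𝔼-*-separate : ∀ (a b : Fin n → ℚ) → 𝔼 (λ i → 𝔼 (λ j → a i * b j)) ≡ 𝔼 a * 𝔼 b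
  𝔼-*-separate a b = trans (𝔼-cong (λ i → 𝔼-*ˡ (a i) b)) (𝔼-*ʳ (𝔼 b) a)

  𝔼-cauchySchwarz : ∀ (f g : Fin n → ℚ) →
    𝔼 (λ i → f i * g i) * 𝔼 (λ i → f i * g i) ≤ 𝔼 (λ i → f i * f i) * 𝔼 (λ i → g i * g i)
  𝔼-cauchySchwarz f g = ≤-byDifference (½ * lagrange) (sym lagrange-identity)
    (nonNeg-* (nonNeg-byComputation ½) (𝔼-nonNeg (λ i → 𝔼-nonNeg (λ j → nonNeg-sq (f i * g j - f j * g i)))))
    where
    F G H : Fin n → ℚ
    F i = f i * f i
    G i = g i * g i
    H i = f i * g i
    lagrange : ℚ
    lagrange = 𝔼 (λ i → 𝔼 (λ j → (f i * g j - f j * g i) * (f i * g j - f j * g i)))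
    expand : ∀ a b c d → (a * d - c * b) * (a * d - c * b) ≡ (a * a) * (d * d) + (c * c) * (b * b) - (+ 2 / 1) * ((a * b) * (c * d))
    expand = solve-∀ ℚ-ring
    linear : ∀ (x y z : Fin n → ℚ) → 𝔼 (λ j → x j + y j - (+ 2 / 1) * z j) ≡ 𝔼 x + 𝔼 y - (+ 2 / 1) * 𝔼 z
    linear x y z = trans (𝔼-minus (λ j → x j + y j) (λ j → (+ 2 / 1) * z j)) (cong₂ _-_ (𝔼-+ x y) (𝔼-*ˡ (+ 2 / 1) z))
    halve : ∀ a b c → ½ * (a * b + a * b - (+ 2 / 1) * (c * c)) ≡ a * b - c * c
    halve = solve-∀ ℚ-ring
    lagrange-identity : ½ * lagrange ≡ 𝔼 F * 𝔼 G - 𝔼 H * 𝔼 H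
    lagrange-identity = begin
      ½ * lagrange
        ≡⟨ cong (½ *_) (𝔼-cong (λ i → 𝔼-cong (λ j → expand (f i) (g i) (f j) (g j)))) ⟩
      ½ * 𝔼 (λ i → 𝔼 (λ j → F i * G j + F j * G i - (+ 2 / 1) * (H i * H j)))
        ≡⟨ cong (½ *_) (trans (𝔼-cong (λ i → linear (λ j → F i * G j) (λ j → F j * G i) (λ j → H i * H j)))
                             (linear (λ i → 𝔼 (λ j → F i * G j)) (λ i → 𝔼 (λ j → F j * G i)) (λ i → 𝔼 (λ j → H i * H j)))) ⟩
      ½ * (𝔼 (λ i → 𝔼 (λ j → F i * G j)) + 𝔼 (λ i → 𝔼 (λ j → F j * G i)) - (+ 2 / 1) * 𝔼 (λ i → 𝔼 (λ j → H i * H j)))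
        ≡⟨ cong (λ z → ½ * z) (cong₂ _-_ (cong₂ _+_ (𝔼-*-separate F G) (trans (𝔼-swap (λ i j → F j * G i)) (𝔼-*-separate F G)))
                                          (cong ((+ 2 / 1) *_) (𝔼-*-separate H H))) ⟩
      ½ * (𝔼 F * 𝔼 G + 𝔼 F * 𝔼 G - (+ 2 / 1) * (𝔼 H * 𝔼 H))
        ≡⟨ halve (𝔼 F) (𝔼 G) (𝔼 H) ⟩
      𝔼 F * 𝔼 G - 𝔼 H * 𝔼 H ∎
      where open ≡-Reasoning

  𝔼²≤𝔼-sq : ∀ (f : Fin n → ℚ) → 𝔼 f * 𝔼 f ≤ 𝔼 (λ i → f i * f i)
  𝔼²≤𝔼-sq f = begin
    𝔼 f * 𝔼 f                                         ≡⟨ cong (λ z → z * z) (𝔼-cong (λ i → *-identityʳ (f i))) ⟨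
    𝔼 (λ i → f i * 1ℚ) * 𝔼 (λ i → f i * 1ℚ)            ≤⟨ 𝔼-cauchySchwarz f (λ _ → 1ℚ) ⟩
    𝔼 (λ i → f i * f i) * 𝔼 (λ _ → 1ℚ)                 ≡⟨ trans (cong (𝔼 (λ i → f i * f i) *_) (𝔼-const 1ℚ)) (*-identityʳ _) ⟩
    𝔼 (λ i → f i * f i)                                ∎
    where open ≤-Reasoning

  Σ≡pow*𝔼 : ∀ m {F g : Fin n → ℚ} → (∀ a → F a ≡ pow (ℕtoℚ n) m * g a) →
            sumFinℚ n F ≡ pow (ℕtoℚ n) (suc m) * 𝔼 g
  Σ≡pow*𝔼 m {F} {g} F≡ = begin
    sumFinℚ n F                                  ≡⟨ Σ≡n*𝔼 F ⟩
    ℕtoℚ n * 𝔼 F                                 ≡⟨ cong (ℕtoℚ n *_) (trans (𝔼-cong F≡) (𝔼-*ˡ (pow (ℕtoℚ n) m) g)) ⟩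
    ℕtoℚ n * (pow (ℕtoℚ n) m * 𝔼 g)              ≡⟨ *-assoc (ℕtoℚ n) _ (𝔼 g) ⟨
    pow (ℕtoℚ n) (suc m) * 𝔼 g                   ∎
    where open ≡-Reasoning

  ℕtoℚ-sumFin≡pow*𝔼 : ∀ m (F : Fin n → ℕ) {g : Fin n → ℚ} → (∀ a → ℕtoℚ (F a) ≡ pow (ℕtoℚ n) m * g a) →
                      ℕtoℚ (sumFin n F) ≡ pow (ℕtoℚ n) (suc m) * 𝔼 g
  ℕtoℚ-sumFin≡pow*𝔼 m F F≡ = trans (ℕtoℚ-sumFin n F) (Σ≡pow*𝔼 m F≡)

  𝔼⁴ : (Fin n → Fin n → Fin n → Fin n → ℚ) → ℚ
  𝔼⁴ g = 𝔼 λ a → 𝔼 λ b → 𝔼 λ c → 𝔼 λ d → g a b c d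

  𝔼⁴-mono-≤ : ∀ {g h : Fin n → Fin n → Fin n → Fin n → ℚ} → (∀ a b c d → g a b c d ≤ h a b c d) → 𝔼⁴ g ≤ 𝔼⁴ h
  𝔼⁴-mono-≤ g≤h = 𝔼-mono-≤ λ a → 𝔼-mono-≤ λ b → 𝔼-mono-≤ λ c → 𝔼-mono-≤ λ d → g≤h a b c d

  𝔼⁴-+ : ∀ (g h : Fin n → Fin n → Fin n → Fin n → ℚ) → 𝔼⁴ (λ a b c d → g a b c d + h a b c d) ≡ 𝔼⁴ g + 𝔼⁴ h
  𝔼⁴-+ g h =
    trans (𝔼-cong λ a →
      trans (𝔼-cong λ b →
        trans (𝔼-cong λ c → 𝔼-+ (g a b c) (h a b c))
              (𝔼-+ (λ c → 𝔼 (g a b c)) (λ c → 𝔼 (h a b c))))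
            (𝔼-+ (λ b → 𝔼 λ c → 𝔼 (g a b c)) (λ b → 𝔼 λ c → 𝔼 (h a b c))))
          (𝔼-+ (λ a → 𝔼 λ b → 𝔼 λ c → 𝔼 (g a b c)) (λ a → 𝔼 λ b → 𝔼 λ c → 𝔼 (h a b c)))

  𝔼⁴-rotate : ∀ (g : Fin n → Fin n → Fin n → Fin n → ℚ) → 𝔼⁴ (λ a b c d → g b c d a) ≡ 𝔼⁴ g
  𝔼⁴-rotate g =
    trans (𝔼-swap λ a b → 𝔼 λ c → 𝔼 λ d → g b c d a)
          (𝔼-cong λ b → trans (𝔼-swap λ a c → 𝔼 λ d → g b c d a)
                              (𝔼-cong λ c → 𝔼-swap λ a d → g b c d a))

-- Polynomial inequalities

p*p≤p : ∀ {p} → 0ℚ ≤ p → p ≤ 1ℚ → p * p ≤ p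
p*p≤p {p} 0≤p p≤1 = ≤-trans (*-monoʳ-≤ p 0≤p p≤1) (≤-reflexive (*-identityˡ p))

sq≤sq⇒∈± : ∀ {a b r} → 0ℚ ≤ r → (a - b) * (a - b) ≤ r * r → b - r ≤ a × a ≤ b + r
sq≤sq⇒∈± {a} {b} {r} 0≤r [a-b]²≤r² =
  ≤-byDifference (r - (b - a)) (ring-solve (a ∷ b ∷ r ∷ []) ℚ-ring)
    (p≤q⇒0≤q-p (sq-cancel-≤ 0≤r (≤-trans (≤-reflexive (flip-sq a b)) [a-b]²≤r²))) ,
  ≤-byDifference (r - (a - b)) (ring-solve (a ∷ b ∷ r ∷ []) ℚ-ring)
    (p≤q⇒0≤q-p (sq-cancel-≤ 0≤r [a-b]²≤r²))
  where
  flip-sq : ∀ a b → (b - a) * (b - a) ≡ (a - b) * (a - b)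
  flip-sq = solve-∀ ℚ-ring

[a+b+c]²≤3[a²+b²+c²] : ∀ a b c → (a + b + c) * (a + b + c) ≤ (+ 3 / 1) * (a * a + b * b + c * c)
[a+b+c]²≤3[a²+b²+c²] a b c = ≤-byDifference _ (sos a b c)
  (nonNeg-+ (nonNeg-+ (nonNeg-sq (a - b)) (nonNeg-sq (b - c))) (nonNeg-sq (a - c)))
  where
  sos : ∀ a b c → (+ 3 / 1) * (a * a + b * b + c * c) - (a + b + c) * (a + b + c) ≡
                  (a - b) * (a - b) + (b - c) * (b - c) + (a - c) * (a - c)
  sos = solve-∀ ℚ-ring

record WalkDensities (s p q x f : ℚ) : Set where
  field
    s∈[0,1] : s ∈[0,1]
    p∈[0,1] : p ∈[0,1]
    f∈[0,1] : f ∈[0,1]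
    s²≤p    : s * s ≤ p
    p²≤q    : p * p ≤ q
    q≤f     : q ≤ f
    x²≤pq   : x * x ≤ p * q
    [x-ps]²≤p[q-p²] : (x - p * s) * (x - p * s) ≤ p * (q - p * p)

extremalGap : ℚ → ℚ → ℚ
extremalGap p f = (f + + 27 / 256) * (f + + 27 / 256) - p * f

-- Both terms vanish exactly at p = 9/16 = (3/4)² and f = p², as for a quasirandom red graph of density 3/4.
extremalGap-lower : ∀ {p f} → 0ℚ ≤ p → p * p ≤ f →
  (+ 9 / 256) * ((p - + 9 / 16) * (p - + 9 / 16)) + (+ 22 / 256) * (f - p * p) ≤ extremalGap p f
extremalGap-lower {p} {f} 0≤p p²≤f = ≤-byDifference _ (certificate p f)
  (nonNeg-+ (nonNeg-+ (nonNeg-* (nonNeg-sq (p - + 9 / 16)) (nonNeg-+ (nonNeg-sq p) (nonNeg-* 0≤p (nonNeg-byComputation (+ 1 / 8)))))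
                      (nonNeg-* 0≤f-p² (nonNeg-* (nonNeg-byComputation (+ 2 / 1)) (nonNeg-sq (p - + 1 / 4)))))
            (nonNeg-sq (f - p * p)))
  where
  0≤f-p² : 0ℚ ≤ f - p * p
  0≤f-p² = p≤q⇒0≤q-p p²≤f
  certificate : ∀ p f → ((f + + 27 / 256) * (f + + 27 / 256) - p * f)
                          - ((+ 9 / 256) * ((p - + 9 / 16) * (p - + 9 / 16)) + (+ 22 / 256) * (f - p * p)) ≡
    ((p - + 9 / 16) * (p - + 9 / 16)) * (p * p + p * (+ 1 / 8))
      + (f - p * p) * ((+ 2 / 1) * ((p - + 1 / 4) * (p - + 1 / 4)))
      + (f - p * p) * (f - p * p)
  certificate = solve-∀ ℚ-ring

extremalGap-nonNeg : ∀ {p f} → 0ℚ ≤ p → p * p ≤ f → 0ℚ ≤ extremalGap p f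
extremalGap-nonNeg {p} {f} 0≤p p²≤f = ≤-trans
  (nonNeg-+ (nonNeg-* (nonNeg-byComputation (+ 9 / 256)) (nonNeg-sq (p - + 9 / 16)))
            (nonNeg-* (nonNeg-byComputation (+ 22 / 256)) (p≤q⇒0≤q-p p²≤f)))
  (extremalGap-lower 0≤p p²≤f)

x≤f+27/256 : ∀ {p f x} → 0ℚ ≤ p → 0ℚ ≤ f → x * x ≤ p * f → p * p ≤ f → x ≤ f + + 27 / 256
x≤f+27/256 {p} {f} 0≤p 0≤f x²≤pf p²≤f = sq-cancel-≤ (nonNeg-+ 0≤f (nonNeg-byComputation (+ 27 / 256)))
  (≤-trans x²≤pf (0≤q-p⇒p≤q (extremalGap-nonNeg 0≤p p²≤f)))

x-f≤27/256 : ∀ {s p q x f} → WalkDensities s p q x f → x - f ≤ + 27 / 256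
x-f≤27/256 {p = p} {q} {x} {f} D = ≤-byDifference _ (rearrange x f) (p≤q⇒0≤q-p
  (x≤f+27/256 0≤p (proj₁ f∈[0,1]) (≤-trans x²≤pq (*-monoˡ-≤ p 0≤p q≤f)) (≤-trans p²≤q q≤f)))
  where
  open WalkDensities D
  0≤p : 0ℚ ≤ p
  0≤p = proj₁ p∈[0,1]
  rearrange : ∀ x f → + 27 / 256 - (x - f) ≡ (f + + 27 / 256) - x
  rearrange = solve-∀ ℚ-ring

module NearExtremal {s p q x f : ℚ} (D : WalkDensities s p q x f) {δ : ℚ}
                    (0<δ : 0ℚ < δ) (δ<ε : δ < + 1 / 1000000)
                    (near : + 27 / 256 - (+ 2 / 1) * δ < x - f) where

  open WalkDensities D

  private
    0≤p : 0ℚ ≤ p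
    0≤p = proj₁ p∈[0,1]
    p≤1 : p ≤ 1ℚ
    p≤1 = proj₂ p∈[0,1]
    0≤f : 0ℚ ≤ f
    0≤f = proj₁ f∈[0,1]
    f≤1 : f ≤ 1ℚ
    f≤1 = proj₂ f∈[0,1]
    0≤δ : 0ℚ ≤ δ
    0≤δ = <⇒≤ 0<δ
    δ≤ε : δ ≤ + 1 / 1000000
    δ≤ε = <⇒≤ δ<ε
    p²≤f : p * p ≤ f
    p²≤f = ≤-trans p²≤q q≤f

  δ*δ≤δ : δ * δ ≤ δ
  δ*δ≤δ = p*p≤p 0≤δ (≤-trans δ≤ε (≤-byComputation _ 1ℚ))

  K*δ≤K*ε : ∀ K → 0ℚ ≤ K → K * δ ≤ K * (+ 1 / 1000000)
  K*δ≤K*ε K 0≤K = *-monoˡ-≤ K 0≤K δ≤ε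

  f+27/256-2δ≤x : f + + 27 / 256 - (+ 2 / 1) * δ ≤ x
  f+27/256-2δ≤x = ≤-byDifference ((x - f) - (+ 27 / 256 - (+ 2 / 1) * δ)) (ring-solve (x ∷ f ∷ δ ∷ []) ℚ-ring)
                                 (<⇒≤ (p<q⇒0<q-p near))

  [f+27/256-2δ]²≤pf : (f + + 27 / 256 - (+ 2 / 1) * δ) * (f + + 27 / 256 - (+ 2 / 1) * δ) ≤ p * f
  [f+27/256-2δ]²≤pf = ≤-trans (sq-mono-≤ 0≤f+27/256-2δ f+27/256-2δ≤x) (≤-trans x²≤pq (*-monoˡ-≤ p 0≤p q≤f))
    where
    2δ≤27/256 : (+ 2 / 1) * δ ≤ + 27 / 256
    2δ≤27/256 = ≤-trans (K*δ≤K*ε (+ 2 / 1) (nonNeg-byComputation _))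
                        (≤-byComputation ((+ 2 / 1) * (+ 1 / 1000000)) (+ 27 / 256))
    0≤f+27/256-2δ : 0ℚ ≤ f + + 27 / 256 - (+ 2 / 1) * δ
    0≤f+27/256-2δ = ≤-byDifference (f + (+ 27 / 256 - (+ 2 / 1) * δ)) (ring-solve (f ∷ δ ∷ []) ℚ-ring)
      (nonNeg-+ 0≤f (p≤q⇒0≤q-p 2δ≤27/256))

  extremalGap≤ : extremalGap p f ≤ (+ 283 / 64) * δ
  extremalGap≤ = ≤-byDifference _ (certificate p f δ)
    (nonNeg-+ (nonNeg-+ (p≤q⇒0≤q-p [f+27/256-2δ]²≤pf)
                        (nonNeg-* (nonNeg-* (nonNeg-byComputation (+ 4 / 1)) 0≤δ) (p≤q⇒0≤q-p f≤1)))
              (nonNeg-* (nonNeg-byComputation (+ 4 / 1)) (nonNeg-sq δ)))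
    where
    certificate : ∀ p f δ → (+ 283 / 64) * δ - ((f + + 27 / 256) * (f + + 27 / 256) - p * f) ≡
      (p * f - (f + + 27 / 256 - (+ 2 / 1) * δ) * (f + + 27 / 256 - (+ 2 / 1) * δ))
        + (+ 4 / 1) * δ * (1ℚ - f) + (+ 4 / 1) * (δ * δ)
    certificate = solve-∀ ℚ-ring

  private
    9/256[p-9/16]²≤gap : (+ 9 / 256) * ((p - + 9 / 16) * (p - + 9 / 16)) ≤ extremalGap p f
    9/256[p-9/16]²≤gap = ≤-trans (p≤p+q (nonNeg-* (nonNeg-byComputation (+ 22 / 256)) (p≤q⇒0≤q-p p²≤f)))
                                 (extremalGap-lower 0≤p p²≤f)

    22/256[f-p²]≤gap : (+ 22 / 256) * (f - p * p) ≤ extremalGap p f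
    22/256[f-p²]≤gap = ≤-trans (q≤p+q (nonNeg-* (nonNeg-byComputation (+ 9 / 256)) (nonNeg-sq (p - + 9 / 16))))
                               (extremalGap-lower 0≤p p²≤f)

  [p-9/16]²≤126δ : (p - + 9 / 16) * (p - + 9 / 16) ≤ (+ 126 / 1) * δ
  [p-9/16]²≤126δ = begin
    (p - + 9 / 16) * (p - + 9 / 16)                        ≡⟨ rescale ((p - + 9 / 16) * (p - + 9 / 16)) ⟩
    (+ 256 / 9) * ((+ 9 / 256) * ((p - + 9 / 16) * (p - + 9 / 16)))
      ≤⟨ *-monoˡ-≤ (+ 256 / 9) (nonNeg-byComputation _) 9/256[p-9/16]²≤gap ⟩
    (+ 256 / 9) * extremalGap p f                          ≤⟨ *-monoˡ-≤ (+ 256 / 9) (nonNeg-byComputation _) extremalGap≤ ⟩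
    (+ 256 / 9) * ((+ 283 / 64) * δ)                       ≡⟨ *-assoc (+ 256 / 9) (+ 283 / 64) δ ⟨
    (+ 256 / 9) * (+ 283 / 64) * δ                         ≤⟨ *-monoʳ-≤ δ 0≤δ (≤-byComputation (+ 256 / 9 * (+ 283 / 64)) (+ 126 / 1)) ⟩
    (+ 126 / 1) * δ                                        ∎
    where
    open ≤-Reasoning
    rescale : ∀ a → a ≡ (+ 256 / 9) * ((+ 9 / 256) * a)
    rescale = solve-∀ ℚ-ring

  f-p²≤52δ : f - p * p ≤ (+ 52 / 1) * δ
  f-p²≤52δ = begin
    f - p * p                                              ≡⟨ rescale (f - p * p) ⟩
    (+ 256 / 22) * ((+ 22 / 256) * (f - p * p))
      ≤⟨ *-monoˡ-≤ (+ 256 / 22) (nonNeg-byComputation _) 22/256[f-p²]≤gap ⟩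
    (+ 256 / 22) * extremalGap p f                         ≤⟨ *-monoˡ-≤ (+ 256 / 22) (nonNeg-byComputation _) extremalGap≤ ⟩
    (+ 256 / 22) * ((+ 283 / 64) * δ)                      ≡⟨ *-assoc (+ 256 / 22) (+ 283 / 64) δ ⟨
    (+ 256 / 22) * (+ 283 / 64) * δ                        ≤⟨ *-monoʳ-≤ δ 0≤δ (≤-byComputation (+ 256 / 22 * (+ 283 / 64)) (+ 52 / 1)) ⟩
    (+ 52 / 1) * δ                                         ∎
    where
    open ≤-Reasoning
    rescale : ∀ a → a ≡ (+ 256 / 22) * ((+ 22 / 256) * a)
    rescale = solve-∀ ℚ-ring

  ½≤p : ½ ≤ p
  ½≤p = proj₁ (sq≤sq⇒∈± {b = + 9 / 16} (nonNeg-byComputation (+ 1 / 16))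
            (≤-trans [p-9/16]²≤126δ (≤-trans (K*δ≤K*ε (+ 126 / 1) (nonNeg-byComputation _))
                                             (≤-byComputation ((+ 126 / 1) * (+ 1 / 1000000)) (+ 1 / 16 * (+ 1 / 16))))))

  [x-ps]²≤52δ : (x - p * s) * (x - p * s) ≤ (+ 52 / 1) * δ
  [x-ps]²≤52δ = ≤-trans [x-ps]²≤p[q-p²]
    (≤-trans (*-monoʳ-≤ (q - p * p) (p≤q⇒0≤q-p p²≤q) p≤1)
      (≤-trans (≤-reflexive (*-identityˡ _)) (≤-trans (+-monoˡ-≤ (- (p * p)) q≤f) f-p²≤52δ)))

  p[3/4-s]≤ : p * (+ 3 / 4 - s) ≤ ∣ x - p * s ∣ + (+ 2 / 1) * δ + ∣ (p - + 9 / 16) * (p - + 3 / 16) ∣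
  p[3/4-s]≤ = ≤-byDifference _ (certificate p s x f δ ∣ x - p * s ∣ ∣ (p - + 9 / 16) * (p - + 3 / 16) ∣)
    (nonNeg-+ (nonNeg-+ (nonNeg-+ (0≤∣p∣-p (x - p * s)) (0≤∣p∣+p ((p - + 9 / 16) * (p - + 3 / 16))))
                        (p≤q⇒0≤q-p f+27/256-2δ≤x))
              (p≤q⇒0≤q-p p²≤f))
    where
    certificate : ∀ p s x f δ ∣a∣ ∣b∣ → (∣a∣ + (+ 2 / 1) * δ + ∣b∣) - p * (+ 3 / 4 - s) ≡
      (((∣a∣ - (x - p * s)) + (∣b∣ + (p - + 9 / 16) * (p - + 3 / 16))) + (x - (f + + 27 / 256 - (+ 2 / 1) * δ))) + (f - p * p)
    certificate = solve-∀ ℚ-ring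

  [s-3/4]²≤2184δ : (s - + 3 / 4) * (s - + 3 / 4) ≤ (+ 2184 / 1) * δ
  [s-3/4]²≤2184δ = [ below , above ]′ (≤-total s (+ 3 / 4))
    where
    y : ℚ
    y = p - + 9 / 16

    [p-3/16]²≤1 : (p - + 3 / 16) * (p - + 3 / 16) ≤ 1ℚ
    [p-3/16]²≤1 = ≤-byDifference _ (factor p)
      (nonNeg-* (p≤q⇒0≤q-p (≤-trans p≤1 (≤-byComputation 1ℚ (+ 19 / 16)))) (nonNeg-+ 0≤p (nonNeg-byComputation (+ 13 / 16))))
      where
      factor : ∀ p → 1ℚ - (p - + 3 / 16) * (p - + 3 / 16) ≡ (+ 19 / 16 - p) * (p + + 13 / 16)
      factor = solve-∀ ℚ-ring

    ∣y[p-3/16]∣²≤126δ : ∣ y * (p - + 3 / 16) ∣ * ∣ y * (p - + 3 / 16) ∣ ≤ (+ 126 / 1) * δ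
    ∣y[p-3/16]∣²≤126δ = begin
      ∣ y * (p - + 3 / 16) ∣ * ∣ y * (p - + 3 / 16) ∣    ≡⟨ ∣p∣*∣p∣≡p*p (y * (p - + 3 / 16)) ⟩
      (y * (p - + 3 / 16)) * (y * (p - + 3 / 16))        ≡⟨ regroup y (p - + 3 / 16) ⟩
      (y * y) * ((p - + 3 / 16) * (p - + 3 / 16))        ≤⟨ *-monoˡ-≤ (y * y) (nonNeg-sq y) [p-3/16]²≤1 ⟩
      (y * y) * 1ℚ                                       ≡⟨ *-identityʳ (y * y) ⟩
      y * y                                              ≤⟨ [p-9/16]²≤126δ ⟩
      (+ 126 / 1) * δ                                    ∎
      where
      open ≤-Reasoning
      regroup : ∀ a b → (a * b) * (a * b) ≡ (a * a) * (b * b)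
      regroup = solve-∀ ℚ-ring

    [2δ]²≤4δ : ((+ 2 / 1) * δ) * ((+ 2 / 1) * δ) ≤ (+ 4 / 1) * δ
    [2δ]²≤4δ = ≤-trans (≤-reflexive (regroup δ)) (*-monoˡ-≤ (+ 4 / 1) (nonNeg-byComputation _) δ*δ≤δ)
      where
      regroup : ∀ δ → ((+ 2 / 1) * δ) * ((+ 2 / 1) * δ) ≡ (+ 4 / 1) * (δ * δ)
      regroup = solve-∀ ℚ-ring

    below : s ≤ + 3 / 4 → (s - + 3 / 4) * (s - + 3 / 4) ≤ (+ 2184 / 1) * δ
    below s≤3/4 = begin
      (s - + 3 / 4) * (s - + 3 / 4)
        ≤⟨ ≤-byDifference _ (factor p s) (nonNeg-* (nonNeg-sq (+ 3 / 4 - s))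
             (nonNeg-* (nonNeg-byComputation (+ 4 / 1)) (nonNeg-* (p≤q⇒0≤q-p ½≤p) (nonNeg-+ 0≤p (nonNeg-byComputation ½))))) ⟩
      (+ 4 / 1) * ((p * (+ 3 / 4 - s)) * (p * (+ 3 / 4 - s)))
        ≤⟨ *-monoˡ-≤ (+ 4 / 1) (nonNeg-byComputation _) (sq-mono-≤ (nonNeg-* 0≤p (p≤q⇒0≤q-p s≤3/4)) p[3/4-s]≤) ⟩
      (+ 4 / 1) * ((a + b + c) * (a + b + c))
        ≤⟨ *-monoˡ-≤ (+ 4 / 1) (nonNeg-byComputation _) ([a+b+c]²≤3[a²+b²+c²] a b c) ⟩
      (+ 4 / 1) * ((+ 3 / 1) * (a * a + b * b + c * c))
        ≤⟨ *-monoˡ-≤ (+ 4 / 1) (nonNeg-byComputation _) (*-monoˡ-≤ (+ 3 / 1) (nonNeg-byComputation _)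
             (+-mono-≤ (+-mono-≤ (≤-trans (≤-reflexive (∣p∣*∣p∣≡p*p (x - p * s))) [x-ps]²≤52δ) [2δ]²≤4δ) ∣y[p-3/16]∣²≤126δ)) ⟩
      (+ 4 / 1) * ((+ 3 / 1) * ((+ 52 / 1) * δ + (+ 4 / 1) * δ + (+ 126 / 1) * δ))
        ≡⟨ ring-solve (δ ∷ []) ℚ-ring ⟩
      (+ 2184 / 1) * δ ∎
      where
      open ≤-Reasoning
      a b c : ℚ
      a = ∣ x - p * s ∣
      b = (+ 2 / 1) * δ
      c = ∣ y * (p - + 3 / 16) ∣
      factor : ∀ p s → (+ 4 / 1) * ((p * (+ 3 / 4 - s)) * (p * (+ 3 / 4 - s))) - (s - + 3 / 4) * (s - + 3 / 4) ≡
                       ((+ 3 / 4 - s) * (+ 3 / 4 - s)) * ((+ 4 / 1) * ((p - ½) * (p + ½)))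
      factor = solve-∀ ℚ-ring

    -- Above 3/4 the bound comes from s² ≤ p alone: p - 9/16 ≥ (3/2)(s - 3/4).
    above : + 3 / 4 ≤ s → (s - + 3 / 4) * (s - + 3 / 4) ≤ (+ 2184 / 1) * δ
    above 3/4≤s = ≤-byDifference _ (certificate δ (s - + 3 / 4))
      (nonNeg-+ (nonNeg-* (nonNeg-byComputation (+ 4 / 9)) (p≤q⇒0≤q-p 9/4[s-3/4]²≤126δ))
                (nonNeg-* (nonNeg-byComputation (+ 2128 / 1)) 0≤δ))
      where
      3/2[s-3/4]≤p-9/16 : (+ 3 / 2) * (s - + 3 / 4) ≤ p - + 9 / 16
      3/2[s-3/4]≤p-9/16 = ≤-byDifference ((p - s * s) + (s - + 3 / 4) * (s - + 3 / 4)) (ring-solve (p ∷ s ∷ []) ℚ-ring)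
        (nonNeg-+ (p≤q⇒0≤q-p s²≤p) (nonNeg-sq (s - + 3 / 4)))
      9/4[s-3/4]²≤126δ : (+ 9 / 4) * ((s - + 3 / 4) * (s - + 3 / 4)) ≤ (+ 126 / 1) * δ
      9/4[s-3/4]²≤126δ = begin
        (+ 9 / 4) * ((s - + 3 / 4) * (s - + 3 / 4))             ≡⟨ ring-solve (s ∷ []) ℚ-ring ⟩
        ((+ 3 / 2) * (s - + 3 / 4)) * ((+ 3 / 2) * (s - + 3 / 4)) ≤⟨ sq-mono-≤ 0≤3/2[s-3/4] 3/2[s-3/4]≤p-9/16 ⟩
        (p - + 9 / 16) * (p - + 9 / 16)                         ≤⟨ [p-9/16]²≤126δ ⟩
        (+ 126 / 1) * δ                                         ∎
        where
        open ≤-Reasoning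
        0≤3/2[s-3/4] : 0ℚ ≤ (+ 3 / 2) * (s - + 3 / 4)
        0≤3/2[s-3/4] = nonNeg-* (nonNeg-byComputation (+ 3 / 2)) (p≤q⇒0≤q-p 3/4≤s)
      certificate : ∀ δ b → (+ 2184 / 1) * δ - b * b ≡ (+ 4 / 9) * ((+ 126 / 1) * δ - (+ 9 / 4) * (b * b)) + (+ 2128 / 1) * δ
      certificate = solve-∀ ℚ-ring

0≤σ-s≤δ : ∀ {σ s m δ} → (σ - s) * m ≡ s → 1ℚ ≤ m * δ → s ∈[0,1] → 0ℚ ≤ δ → 0ℚ ≤ σ - s × σ - s ≤ δ
0≤σ-s≤δ {σ} {s} {m} {δ} [σ-s]m≡s 1≤mδ (0≤s , s≤1) 0≤δ = 0≤σ-s , σ-s≤δ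
  where
  0<m : 0ℚ < m
  0<m = *-cancelʳ-<-nonNeg δ {{nonNegative 0≤δ}}
          (<-≤-trans (≤-<-trans (≤-reflexive (*-zeroˡ δ)) (<-byComputation 0ℚ 1ℚ)) 1≤mδ)
  0≤σ-s : 0ℚ ≤ σ - s
  0≤σ-s = *-cancelʳ-≤-pos m {{positive 0<m}}
            (≤-trans (≤-reflexive (*-zeroˡ m)) (≤-trans 0≤s (≤-reflexive (sym [σ-s]m≡s))))
  σ-s≤δ : σ - s ≤ δ
  σ-s≤δ = begin
    σ - s             ≡⟨ *-identityʳ (σ - s) ⟨
    (σ - s) * 1ℚ      ≤⟨ *-monoˡ-≤ (σ - s) 0≤σ-s 1≤mδ ⟩
    (σ - s) * (m * δ) ≡⟨ *-assoc (σ - s) m δ ⟨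
    (σ - s) * m * δ   ≡⟨ cong (_* δ) [σ-s]m≡s ⟩
    s * δ             ≤⟨ *-monoʳ-≤ δ 0≤δ s≤1 ⟩
    1ℚ * δ            ≡⟨ *-identityˡ δ ⟩
    δ                 ∎
    where open ≤-Reasoning

[σ-3/4]²≤4370δ : ∀ {σ s δ} → (s - + 3 / 4) * (s - + 3 / 4) ≤ (+ 2184 / 1) * δ →
                 0ℚ ≤ σ - s → σ - s ≤ δ → δ * δ ≤ δ →
                 (σ - + 3 / 4) * (σ - + 3 / 4) ≤ (+ 4370 / 1) * δ
[σ-3/4]²≤4370δ {σ} {s} {δ} [s-3/4]²≤2184δ 0≤σ-s σ-s≤δ δ²≤δ = ≤-byDifference _ (certificate δ s σ)
  (nonNeg-+ (nonNeg-+ (nonNeg-* (nonNeg-byComputation (+ 2 / 1)) (p≤q⇒0≤q-p [s-3/4]²≤2184δ))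
                      (nonNeg-* (nonNeg-byComputation (+ 2 / 1)) (p≤q⇒0≤q-p [σ-s]²≤δ)))
            (nonNeg-sq ((s - + 3 / 4) - (σ - s))))
  where
  [σ-s]²≤δ : (σ - s) * (σ - s) ≤ δ
  [σ-s]²≤δ = ≤-trans (sq-mono-≤ 0≤σ-s σ-s≤δ) δ²≤δ
  certificate : ∀ δ s σ → (+ 4370 / 1) * δ - (σ - + 3 / 4) * (σ - + 3 / 4) ≡
     ((+ 2 / 1) * ((+ 2184 / 1) * δ - (s - + 3 / 4) * (s - + 3 / 4)) + (+ 2 / 1) * (δ - (σ - s) * (σ - s)))
       + ((s - + 3 / 4) - (σ - s)) * ((s - + 3 / 4) - (σ - s))
  certificate = solve-∀ ℚ-ring

∣z∣⁴≤4⁴δ : ∀ {z δ} → z * z ≤ (+ 4370 / 1) * δ → 0ℚ ≤ δ → δ ≤ + 1 / 1000000 → pow ∣ z ∣ 4 ≤ pow (+ 4 / 1) 4 * δ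
∣z∣⁴≤4⁴δ {z} {δ} z²≤4370δ 0≤δ δ≤ε = begin
  pow ∣ z ∣ 4                                       ≡⟨ pow-4 ∣ z ∣ ⟩
  (∣ z ∣ * ∣ z ∣) * (∣ z ∣ * ∣ z ∣)                 ≡⟨ cong (λ w → w * w) (∣p∣*∣p∣≡p*p z) ⟩
  (z * z) * (z * z)                                 ≤⟨ sq-mono-≤ (nonNeg-sq z) z²≤4370δ ⟩
  ((+ 4370 / 1) * δ) * ((+ 4370 / 1) * δ)           ≤⟨ ≤-byDifference _ (certificate δ)
                                                         (nonNeg-+ (nonNeg-* (nonNeg-* (nonNeg-byComputation (+ 19096900 / 1)) 0≤δ) (p≤q⇒0≤q-p δ≤ε))
                                                                   (nonNeg-* (nonNeg-byComputation (+ 256 / 1 - + 19096900 / 1 * (+ 1 / 1000000))) 0≤δ)) ⟩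
  pow (+ 4 / 1) 4 * δ                               ∎
  where
  open ≤-Reasoning
  pow-4 : ∀ w → w * (w * (w * (w * 1ℚ))) ≡ (w * w) * (w * w)
  pow-4 = solve-∀ ℚ-ring
  certificate : ∀ δ → (+ 256 / 1) * δ - ((+ 4370 / 1) * δ) * ((+ 4370 / 1) * δ) ≡
      ((+ 19096900 / 1) * δ) * (+ 1 / 1000000 - δ) + (+ 256 / 1 - + 19096900 / 1 * (+ 1 / 1000000)) * δ
  certificate = solve-∀ ℚ-ring

[w+∣p-σ²∣]⁸<4⁸δ : ∀ {w p σ δ} → 0ℚ ≤ w → w * w ≤ (+ 52 / 1) * δ →
                  (p - + 9 / 16) * (p - + 9 / 16) ≤ (+ 126 / 1) * δ →
                  (σ - + 3 / 4) * (σ - + 3 / 4) ≤ (+ 4370 / 1) * δ →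
                  0ℚ < δ → δ ≤ + 1 / 1000000 →
                  pow (w + ∣ p - σ * σ ∣) 8 < pow (+ 4 / 1) 8 * δ
[w+∣p-σ²∣]⁸<4⁸δ {w} {p} {σ} {δ} 0≤w w²≤52δ [p-9/16]²≤126δ [σ-3/4]²≤4370δ 0<δ δ≤ε = begin-strict
  pow z 8                                                       ≡⟨ pow-8 z ⟩
  ((z * z) * (z * z)) * ((z * z) * (z * z))                     ≤⟨ sq-mono-≤ (nonNeg-sq (z * z)) (sq-mono-≤ (nonNeg-sq z) z²≤70528δ) ⟩
  (((+ 70528 / 1) * δ) * ((+ 70528 / 1) * δ)) * (((+ 70528 / 1) * δ) * ((+ 70528 / 1) * δ))
                                                                ≡⟨ regroup δ ⟩
  (+ 70528 / 1) ^4 * (δ * δ * δ) * δ                            ≤⟨ *-monoʳ-≤ δ 0≤δ (*-monoˡ-≤ ((+ 70528 / 1) ^4) (nonNeg-byComputation _) δ³≤ε³) ⟩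
  (+ 70528 / 1) ^4 * (ε * ε * ε) * δ                            <⟨ *-monoˡ-<-pos δ {{positive 0<δ}} (<-byComputation ((+ 70528 / 1) ^4 * (ε * ε * ε)) (pow (+ 4 / 1) 8)) ⟩
  pow (+ 4 / 1) 8 * δ                                           ∎
  where
  open ≤-Reasoning
  ε : ℚ
  ε = + 1 / 1000000
  _^4 : ℚ → ℚ
  r ^4 = (r * r) * (r * r)
  z : ℚ
  z = w + ∣ p - σ * σ ∣
  0≤δ : 0ℚ ≤ δ
  0≤δ = <⇒≤ 0<δ
  Kδ≤Kε : ∀ K → 0ℚ ≤ K → K * δ ≤ K * ε
  Kδ≤Kε K 0≤K = *-monoˡ-≤ K 0≤K δ≤ε

  σ∈[1/2,1] : + 3 / 4 - + 1 / 4 ≤ σ × σ ≤ + 3 / 4 + + 1 / 4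
  σ∈[1/2,1] = sq≤sq⇒∈± {b = + 3 / 4} (nonNeg-byComputation (+ 1 / 4))
    (≤-trans [σ-3/4]²≤4370δ (≤-trans (Kδ≤Kε (+ 4370 / 1) (nonNeg-byComputation _))
                                     (≤-byComputation ((+ 4370 / 1) * ε) (+ 1 / 4 * (+ 1 / 4)))))

  [p-σ²]²≤ : (p - σ * σ) * (p - σ * σ) ≤ (+ 2 / 1) * ((p - + 9 / 16) * (p - + 9 / 16)) + (+ 8 / 1) * ((σ - + 3 / 4) * (σ - + 3 / 4))
  [p-σ²]²≤ = ≤-byDifference _ (certificate p σ)
    (nonNeg-+ (nonNeg-sq ((p - + 9 / 16) - (+ 3 / 4 - σ) * (+ 3 / 4 + σ)))
              (nonNeg-* (nonNeg-* (nonNeg-byComputation (+ 2 / 1)) (nonNeg-sq (σ - + 3 / 4)))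
                        (nonNeg-* (p≤q⇒0≤q-p (≤-trans (proj₂ σ∈[1/2,1]) (≤-byComputation (+ 3 / 4 + + 1 / 4) (+ 5 / 4))))
                                  (nonNeg-+ (≤-trans (≤-byComputation 0ℚ (+ 3 / 4 - + 1 / 4)) (proj₁ σ∈[1/2,1])) (nonNeg-byComputation (+ 11 / 4))))))
    where
    certificate : ∀ p σ → ((+ 2 / 1) * ((p - + 9 / 16) * (p - + 9 / 16)) + (+ 8 / 1) * ((σ - + 3 / 4) * (σ - + 3 / 4))) - (p - σ * σ) * (p - σ * σ) ≡
       ((p - + 9 / 16) - (+ 3 / 4 - σ) * (+ 3 / 4 + σ)) * ((p - + 9 / 16) - (+ 3 / 4 - σ) * (+ 3 / 4 + σ))
         + ((+ 2 / 1) * ((σ - + 3 / 4) * (σ - + 3 / 4))) * ((+ 5 / 4 - σ) * (σ + + 11 / 4))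
    certificate = solve-∀ ℚ-ring

  z²≤70528δ : z * z ≤ (+ 70528 / 1) * δ
  z²≤70528δ = begin
    z * z
      ≤⟨ ≤-byDifference _ (certificate w ∣ p - σ * σ ∣) (nonNeg-sq (w - ∣ p - σ * σ ∣)) ⟩
    (+ 2 / 1) * (w * w) + (+ 2 / 1) * (∣ p - σ * σ ∣ * ∣ p - σ * σ ∣)
      ≡⟨ cong (λ v → (+ 2 / 1) * (w * w) + (+ 2 / 1) * v) (∣p∣*∣p∣≡p*p (p - σ * σ)) ⟩
    (+ 2 / 1) * (w * w) + (+ 2 / 1) * ((p - σ * σ) * (p - σ * σ))
      ≤⟨ +-mono-≤ (*-monoˡ-≤ (+ 2 / 1) (nonNeg-byComputation _) w²≤52δ)
                  (*-monoˡ-≤ (+ 2 / 1) (nonNeg-byComputation _) (≤-trans [p-σ²]²≤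
                    (+-mono-≤ (*-monoˡ-≤ (+ 2 / 1) (nonNeg-byComputation _) [p-9/16]²≤126δ)
                              (*-monoˡ-≤ (+ 8 / 1) (nonNeg-byComputation _) [σ-3/4]²≤4370δ)))) ⟩
    (+ 2 / 1) * ((+ 52 / 1) * δ) + (+ 2 / 1) * ((+ 2 / 1) * ((+ 126 / 1) * δ) + (+ 8 / 1) * ((+ 4370 / 1) * δ))
      ≡⟨ ring-solve (δ ∷ []) ℚ-ring ⟩
    (+ 70528 / 1) * δ ∎
    where
    certificate : ∀ a b → ((+ 2 / 1) * (a * a) + (+ 2 / 1) * (b * b)) - (a + b) * (a + b) ≡ (a - b) * (a - b)
    certificate = solve-∀ ℚ-ring

  δ³≤ε³ : δ * δ * δ ≤ ε * ε * ε
  δ³≤ε³ = *-mono-≤ (nonNeg-sq δ) 0≤δ (sq-mono-≤ 0≤δ δ≤ε) δ≤ε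

  pow-8 : ∀ w → w * (w * (w * (w * (w * (w * (w * (w * 1ℚ))))))) ≡ ((w * w) * (w * w)) * ((w * w) * (w * w))
  pow-8 = solve-∀ ℚ-ring

  regroup : ∀ δ → (((+ 70528 / 1) * δ) * ((+ 70528 / 1) * δ)) * (((+ 70528 / 1) * δ) * ((+ 70528 / 1) * δ)) ≡
                  (+ 70528 / 1) ^4 * (δ * δ * δ) * δ
  regroup = solve-∀ ℚ-ring

-- The red graph

neq-sym : ∀ {n} (a b : Fin n) → neq a b ≡ neq b a
neq-sym a b with a Fin.≟ b | b Fin.≟ a
... | yes _   | yes _   = refl
... | no  _   | no  _   = refl
... | yes a≡b | no  b≢a = contradiction (sym a≡b) b≢a
... | no  a≢b | yes b≡a = contradiction (sym b≡a) a≢b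

distinct4-rotate : ∀ {n} (a b c d : Fin n) → distinct4 b c d a ≡ distinct4 a b c d
distinct4-rotate a b c d rewrite neq-sym b a | neq-sym c a | neq-sym d a =
  ∧-rearrange (neq a b) (neq a c) (neq a d) (neq b c) (neq b d) (neq c d)

module RedGraph {k : ℕ} (G : RedBlueK (suc k)) where

  open Averages k

  private
    n : ℕ
    n = suc k

    N : ℚ
    N = ℕtoℚ n

    col : Fin n → Fin n → Bool
    col = proj₁ G
    col-sym : ∀ i j → col i j ≡ col j i
    col-sym = proj₂ G

  redℕ : Fin n → Fin n → ℕ
  redℕ i j = ⟦ neq i j ∧ col i j ⟧

  red : Fin n → Fin n → ℚ
  red i j = ℕtoℚ (redℕ i j)

  red-sym : ∀ i j → red i j ≡ red j i
  red-sym i j rewrite neq-sym i j | col-sym i j = refl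

  red∈[0,1] : ∀ i j → red i j ∈[0,1]
  red∈[0,1] i j = 0≤ℕtoℚ (redℕ i j) , ℕtoℚ-mono-≤ (⟦⟧≤1 (neq i j ∧ col i j))

  deg : Fin n → ℚ
  deg i = 𝔼 (red i)

  cod : Fin n → Fin n → ℚ
  cod i j = 𝔼 λ z → red i z * red z j

  deg₂ : Fin n → ℚ
  deg₂ i = 𝔼 λ j → red i j * deg j

  s p q x f : ℚ
  s = 𝔼 deg
  p = 𝔼 λ i → deg i * deg i
  q = 𝔼 λ i → deg₂ i * deg₂ i
  x = 𝔼 λ i → deg i * deg₂ i
  f = 𝔼 λ i → 𝔼 λ j → cod i j * cod i j

  deg∈[0,1] : ∀ i → deg i ∈[0,1]
  deg∈[0,1] i = 𝔼-∈[0,1] (red∈[0,1] i)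

  cod∈[0,1] : ∀ i j → cod i j ∈[0,1]
  cod∈[0,1] i j = 𝔼-∈[0,1] λ z → ∈[0,1]-* (red∈[0,1] i z) (red∈[0,1] z j)

  cod-sym : ∀ i j → cod j i ≡ cod i j
  cod-sym i j = 𝔼-cong λ z → trans (*-comm (red j z) (red z i)) (cong₂ _*_ (red-sym z i) (red-sym j z))

  deg₂≡𝔼cod : ∀ i → deg₂ i ≡ 𝔼 (cod i)
  deg₂≡𝔼cod i = trans (𝔼-cong λ j → sym (𝔼-*ˡ (red i j) (red j))) (𝔼-swap λ j z → red i j * red j z)

  𝔼-red-column : ∀ j → 𝔼 (λ i → red i j) ≡ deg j
  𝔼-red-column j = 𝔼-cong λ i → red-sym i j

  𝔼deg₂≡p : 𝔼 deg₂ ≡ p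
  𝔼deg₂≡p = begin
    𝔼 (λ i → 𝔼 λ j → red i j * deg j) ≡⟨ 𝔼-swap (λ i j → red i j * deg j) ⟩
    𝔼 (λ j → 𝔼 λ i → red i j * deg j) ≡⟨ 𝔼-cong (λ j → 𝔼-*ʳ (deg j) (λ i → red i j)) ⟩
    𝔼 (λ j → 𝔼 (λ i → red i j) * deg j) ≡⟨ 𝔼-cong (λ j → cong (_* deg j) (𝔼-red-column j)) ⟩
    p ∎
    where open ≡-Reasoning

  [x-ps]²≤p[q-p²] : (x - p * s) * (x - p * s) ≤ p * (q - p * p)
  [x-ps]²≤p[q-p²] = subst₂ _≤_ (cong (λ z → z * z) 𝔼deg[deg₂-p]) (cong (p *_) 𝔼[deg₂-p]²)
                             (𝔼-cauchySchwarz deg (λ i → deg₂ i - p))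
    where
    open ≡-Reasoning
    𝔼deg[deg₂-p] : 𝔼 (λ i → deg i * (deg₂ i - p)) ≡ x - p * s
    𝔼deg[deg₂-p] = begin
      𝔼 (λ i → deg i * (deg₂ i - p))       ≡⟨ 𝔼-cong (λ i → distrib (deg i) (deg₂ i) p) ⟩
      𝔼 (λ i → deg i * deg₂ i - p * deg i) ≡⟨ 𝔼-minus (λ i → deg i * deg₂ i) (λ i → p * deg i) ⟩
      x - 𝔼 (λ i → p * deg i)              ≡⟨ cong (_-_ x) (𝔼-*ˡ p deg) ⟩
      x - p * s                            ∎
      where
      distrib : ∀ a b c → a * (b - c) ≡ a * b - c * a
      distrib = solve-∀ ℚ-ring
    𝔼[deg₂-p]² : 𝔼 (λ i → (deg₂ i - p) * (deg₂ i - p)) ≡ q - p * p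
    𝔼[deg₂-p]² = begin
      𝔼 (λ i → (deg₂ i - p) * (deg₂ i - p))
        ≡⟨ 𝔼-cong (λ i → expand (deg₂ i) p) ⟩
      𝔼 (λ i → (deg₂ i * deg₂ i - (p + p) * deg₂ i) + p * p)
        ≡⟨ 𝔼-+ (λ i → deg₂ i * deg₂ i - (p + p) * deg₂ i) (λ _ → p * p) ⟩
      𝔼 (λ i → deg₂ i * deg₂ i - (p + p) * deg₂ i) + 𝔼 (λ _ → p * p)
        ≡⟨ cong₂ _+_ (𝔼-minus (λ i → deg₂ i * deg₂ i) (λ i → (p + p) * deg₂ i)) (𝔼-const (p * p)) ⟩
      (q - 𝔼 (λ i → (p + p) * deg₂ i)) + p * p
        ≡⟨ cong (λ z → (q - z) + p * p) (trans (𝔼-*ˡ (p + p) deg₂) (cong ((p + p) *_) 𝔼deg₂≡p)) ⟩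
      (q - (p + p) * p) + p * p
        ≡⟨ cancel q p ⟩
      q - p * p ∎
      where
      expand : ∀ a b → (a - b) * (a - b) ≡ (a * a - (b + b) * a) + b * b
      expand = solve-∀ ℚ-ring
      cancel : ∀ a b → (a - (b + b) * b) + b * b ≡ a - b * b
      cancel = solve-∀ ℚ-ring

  walkDensities : WalkDensities s p q x f
  walkDensities = record
    { s∈[0,1] = 𝔼-∈[0,1] deg∈[0,1]
    ; p∈[0,1] = 𝔼-∈[0,1] λ i → ∈[0,1]-sq (deg∈[0,1] i)
    ; f∈[0,1] = 𝔼-∈[0,1] λ i → 𝔼-∈[0,1] λ j → ∈[0,1]-sq (cod∈[0,1] i j)
    ; s²≤p    = 𝔼²≤𝔼-sq deg
    ; p²≤q    = subst (λ z → z * z ≤ q) 𝔼deg₂≡p (𝔼²≤𝔼-sq deg₂)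
    ; q≤f     = 𝔼-mono-≤ λ i → subst (λ z → z * z ≤ 𝔼 λ j → cod i j * cod i j) (sym (deg₂≡𝔼cod i)) (𝔼²≤𝔼-sq (cod i))
    ; x²≤pq   = 𝔼-cauchySchwarz deg deg₂
    ; [x-ps]²≤p[q-p²] = [x-ps]²≤p[q-p²]
    }

  rrrbAt : Fin n → Fin n → Fin n → Fin n → ℕ
  rrrbAt a b c d = ⟦ distinct4 a b c d ∧ exactlyOneFalse (col a b) (col b c) (col c d) (col d a) ⟧

  redPathBlueClosing : Fin n → Fin n → Fin n → Fin n → ℕ
  redPathBlueClosing a b c d = ⟦ distinct4 a b c d ∧ col a b ∧ col b c ∧ col c d ∧ not (col d a) ⟧

  rrrbAt≤ : ∀ a b c d → rrrbAt a b c d ℕ.≤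
    redPathBlueClosing b c d a ℕ.+ redPathBlueClosing c d a b ℕ.+ redPathBlueClosing d a b c ℕ.+ redPathBlueClosing a b c d
  rrrbAt≤ a b c d
    rewrite distinct4-rotate a b c d
          | trans (distinct4-rotate b c d a) (distinct4-rotate a b c d)
          | trans (distinct4-rotate c d a b) (trans (distinct4-rotate b c d a) (distinct4-rotate a b c d)) =
    ⟦exactlyOneFalse⟧≤ (distinct4 a b c d) (col a b) (col b c) (col c d) (col d a)

  redPathBlueClosing+cycle≤path : ∀ a b c d →
    ℕtoℚ (redPathBlueClosing a b c d) + red a b * red b c * red c d * red d a ≤ red a b * red b c * red c d
  redPathBlueClosing+cycle≤path a b c d = subst₂ _≤_ cast-lhs cast-rhs (ℕtoℚ-mono-≤
    (⟦open-path⟧+⟦closed-walk⟧≤⟦path⟧ (neq a b) (neq a c) (neq a d) (neq b c) (neq b d) (neq c d) (neq d a)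
                                      (col a b) (col b c) (col c d) (col d a)))
    where
    path : ℕ
    path = redℕ a b ℕ.* redℕ b c ℕ.* redℕ c d
    cast-rhs : ℕtoℚ path ≡ red a b * red b c * red c d
    cast-rhs = trans (ℕtoℚ-* (redℕ a b ℕ.* redℕ b c) (redℕ c d)) (cong (_* red c d) (ℕtoℚ-* (redℕ a b) (redℕ b c)))
    cast-lhs : ℕtoℚ (redPathBlueClosing a b c d ℕ.+ path ℕ.* redℕ d a) ≡
               ℕtoℚ (redPathBlueClosing a b c d) + red a b * red b c * red c d * red d a
    cast-lhs = trans (ℕtoℚ-+ (redPathBlueClosing a b c d) (path ℕ.* redℕ d a))
                     (cong (_+_ (ℕtoℚ (redPathBlueClosing a b c d))) (trans (ℕtoℚ-* path (redℕ d a)) (cong (_* red d a) cast-rhs)))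

  𝔼⁴-path≡x : 𝔼⁴ (λ a b c d → red a b * red b c * red c d) ≡ x
  𝔼⁴-path≡x = begin
    𝔼⁴ (λ a b c d → red a b * red b c * red c d)
      ≡⟨ 𝔼-cong (λ a → 𝔼-cong λ b → 𝔼-cong λ c → 𝔼-*ˡ (red a b * red b c) (red c)) ⟩
    𝔼 (λ a → 𝔼 λ b → 𝔼 λ c → red a b * red b c * deg c)
      ≡⟨ 𝔼-cong (λ a → 𝔼-cong λ b → trans (𝔼-cong λ c → *-assoc (red a b) (red b c) (deg c))
                                          (𝔼-*ˡ (red a b) (λ c → red b c * deg c))) ⟩
    𝔼 (λ a → 𝔼 λ b → red a b * deg₂ b)
      ≡⟨ 𝔼-swap (λ a b → red a b * deg₂ b) ⟩
    𝔼 (λ b → 𝔼 λ a → red a b * deg₂ b)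
      ≡⟨ 𝔼-cong (λ b → trans (𝔼-*ʳ (deg₂ b) (λ a → red a b)) (cong (_* deg₂ b) (𝔼-red-column b))) ⟩
    x ∎
    where open ≡-Reasoning

  𝔼⁴-cycle≡f : 𝔼⁴ (λ a b c d → red a b * red b c * red c d * red d a) ≡ f
  𝔼⁴-cycle≡f = begin
    𝔼⁴ (λ a b c d → red a b * red b c * red c d * red d a)
      ≡⟨ 𝔼-cong (λ a → 𝔼-cong λ b → 𝔼-cong λ c →
           trans (𝔼-cong λ d → *-assoc (red a b * red b c) (red c d) (red d a))
                 (𝔼-*ˡ (red a b * red b c) (λ d → red c d * red d a))) ⟩
    𝔼 (λ a → 𝔼 λ b → 𝔼 λ c → red a b * red b c * cod c a)
      ≡⟨ 𝔼-cong (λ a → 𝔼-swap λ b c → red a b * red b c * cod c a) ⟩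
    𝔼 (λ a → 𝔼 λ c → 𝔼 λ b → red a b * red b c * cod c a)
      ≡⟨ 𝔼-cong (λ a → 𝔼-cong λ c → trans (𝔼-*ʳ (cod c a) (λ b → red a b * red b c)) (cong (cod a c *_) (cod-sym a c))) ⟩
    f ∎
    where open ≡-Reasoning

  𝔼⁴-redPathBlueClosing≤x-f : 𝔼⁴ (λ a b c d → ℕtoℚ (redPathBlueClosing a b c d)) ≤ x - f
  𝔼⁴-redPathBlueClosing≤x-f = ≤-byDifference _ (rearrange x (𝔼⁴ h) f) (p≤q⇒0≤q-p (subst₂ _≤_
    (trans (𝔼⁴-+ h (λ a b c d → red a b * red b c * red c d * red d a)) (cong (_+_ (𝔼⁴ h)) 𝔼⁴-cycle≡f))
    𝔼⁴-path≡x
    (𝔼⁴-mono-≤ redPathBlueClosing+cycle≤path)))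
    where
    h : Fin n → Fin n → Fin n → Fin n → ℚ
    h a b c d = ℕtoℚ (redPathBlueClosing a b c d)
    rearrange : ∀ x h f → (x - f) - h ≡ x - (h + f)
    rearrange = solve-∀ ℚ-ring

  𝔼⁴-rrrbAt≤4[x-f] : 𝔼⁴ (λ a b c d → ℕtoℚ (rrrbAt a b c d)) ≤ (+ 4 / 1) * (x - f)
  𝔼⁴-rrrbAt≤4[x-f] = begin
    𝔼⁴ (λ a b c d → ℕtoℚ (rrrbAt a b c d))
      ≤⟨ 𝔼⁴-mono-≤ (λ a b c d → ≤-trans (ℕtoℚ-mono-≤ (rrrbAt≤ a b c d)) (≤-reflexive (cast a b c d))) ⟩
    𝔼⁴ (λ a b c d → h b c d a + h c d a b + h d a b c + h a b c d)
      ≡⟨ trans (𝔼⁴-+ (λ a b c d → h b c d a + h c d a b + h d a b c) h)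
               (cong (_+ 𝔼⁴ h) (trans (𝔼⁴-+ (λ a b c d → h b c d a + h c d a b) (λ a b c d → h d a b c))
                 (cong₂ _+_ (trans (𝔼⁴-+ (λ a b c d → h b c d a) (λ a b c d → h c d a b)) (cong₂ _+_ rot₁ rot₂)) rot₃))) ⟩
    𝔼⁴ h + 𝔼⁴ h + 𝔼⁴ h + 𝔼⁴ h
      ≡⟨ four (𝔼⁴ h) ⟩
    (+ 4 / 1) * 𝔼⁴ h
      ≤⟨ *-monoˡ-≤ (+ 4 / 1) (nonNeg-byComputation _) 𝔼⁴-redPathBlueClosing≤x-f ⟩
    (+ 4 / 1) * (x - f) ∎
    where
    open ≤-Reasoning
    hℕ : Fin n → Fin n → Fin n → Fin n → ℕ
    hℕ = redPathBlueClosing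
    h : Fin n → Fin n → Fin n → Fin n → ℚ
    h a b c d = ℕtoℚ (hℕ a b c d)
    cast : ∀ a b c d → ℕtoℚ (hℕ b c d a ℕ.+ hℕ c d a b ℕ.+ hℕ d a b c ℕ.+ hℕ a b c d)
                     ≡ h b c d a + h c d a b + h d a b c + h a b c d
    cast a b c d =
      trans (ℕtoℚ-+ (hℕ b c d a ℕ.+ hℕ c d a b ℕ.+ hℕ d a b c) (hℕ a b c d)) (cong (_+ h a b c d)
      (trans (ℕtoℚ-+ (hℕ b c d a ℕ.+ hℕ c d a b) (hℕ d a b c)) (cong (_+ h d a b c)
      (ℕtoℚ-+ (hℕ b c d a) (hℕ c d a b)))))
    rot₁ : 𝔼⁴ (λ a b c d → h b c d a) ≡ 𝔼⁴ h
    rot₁ = 𝔼⁴-rotate h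
    rot₂ : 𝔼⁴ (λ a b c d → h c d a b) ≡ 𝔼⁴ h
    rot₂ = trans (𝔼⁴-rotate (λ a b c d → h b c d a)) rot₁
    rot₃ : 𝔼⁴ (λ a b c d → h d a b c) ≡ 𝔼⁴ h
    rot₃ = trans (𝔼⁴-rotate (λ a b c d → h c d a b)) rot₂
    four : ∀ z → z + z + z + z ≡ (+ 4 / 1) * z
    four = solve-∀ ℚ-ring

  rrrbTuples≤ : ℕtoℚ (rrrbTuples G) ≤ pow N 4 * ((+ 4 / 1) * (x - f))
  rrrbTuples≤ = ≤-trans (≤-reflexive rrrbTuples≡) (*-monoˡ-≤ (pow N 4) (pow-nonNeg 4 (0≤ℕtoℚ n)) 𝔼⁴-rrrbAt≤4[x-f])
    where
    rrrbTuples≡ : ℕtoℚ (rrrbTuples G) ≡ pow N 4 * 𝔼⁴ (λ a b c d → ℕtoℚ (rrrbAt a b c d))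
    rrrbTuples≡ =
      ℕtoℚ-sumFin≡pow*𝔼 3 (λ a → sumFin n λ b → sumFin n λ c → sumFin n λ d → rrrbAt a b c d) λ a →
      ℕtoℚ-sumFin≡pow*𝔼 2 (λ b → sumFin n λ c → sumFin n λ d → rrrbAt a b c d) λ b →
      ℕtoℚ-sumFin≡pow*𝔼 1 (λ c → sumFin n λ d → rrrbAt a b c d) λ c →
      ℕtoℚ-sumFin≡pow*𝔼 0 (rrrbAt a b c) λ d → sym (*-identityˡ (ℕtoℚ (rrrbAt a b c d)))

  redOrdered≡ : ℕtoℚ (redOrdered G) ≡ pow N 2 * s
  redOrdered≡ = ℕtoℚ-sumFin≡pow*𝔼 1 (λ a → sumFin n (redℕ a)) λ a →
                ℕtoℚ-sumFin≡pow*𝔼 0 (redℕ a) λ b → sym (*-identityˡ (red a b))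

  codeg≡ : ∀ i j → ℕtoℚ (codeg G i j) ≡ pow N 1 * cod i j
  codeg≡ i j = ℕtoℚ-sumFin≡pow*𝔼 0 (λ z → ⟦ neq z i ∧ neq z j ∧ col i z ∧ col j z ⟧) λ z →
    trans (cong ℕtoℚ (common-neighbour z)) (trans (ℕtoℚ-* (redℕ i z) (redℕ z j)) (sym (*-identityˡ _)))
    where
    common-neighbour : ∀ z → ⟦ neq z i ∧ neq z j ∧ col i z ∧ col j z ⟧ ≡ redℕ i z ℕ.* redℕ z j
    common-neighbour z rewrite ∧-interchange (neq z i) (neq z j) (col i z) (col j z)
                             | neq-sym z i | col-sym j z = ⟦∧⟧ (neq i z ∧ col i z) (neq z j ∧ col z j)

  codegDeviation : ℚ → ℚ
  codegDeviation μ = 𝔼 λ i → 𝔼 λ j → ∣ cod i j - μ ∣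

  codegDeviation-nonNeg : ∀ μ → 0ℚ ≤ codegDeviation μ
  codegDeviation-nonNeg μ = 𝔼-nonNeg λ i → 𝔼-nonNeg λ j → 0≤∣p∣ (cod i j - μ)

  codegDeviation[p]²≤f-p² : codegDeviation p * codegDeviation p ≤ f - p * p
  codegDeviation[p]²≤f-p² = begin
    codegDeviation p * codegDeviation p
      ≤⟨ 𝔼²≤𝔼-sq (λ i → 𝔼 λ j → ∣ cod i j - p ∣) ⟩
    𝔼 (λ i → 𝔼 (λ j → ∣ cod i j - p ∣) * 𝔼 (λ j → ∣ cod i j - p ∣))
      ≤⟨ 𝔼-mono-≤ (λ i → 𝔼²≤𝔼-sq (λ j → ∣ cod i j - p ∣)) ⟩
    𝔼 (λ i → 𝔼 λ j → ∣ cod i j - p ∣ * ∣ cod i j - p ∣)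
      ≡⟨ 𝔼-cong (λ i → 𝔼-cong λ j → trans (∣p∣*∣p∣≡p*p (cod i j - p)) (expand (cod i j) p)) ⟩
    𝔼 (λ i → 𝔼 λ j → (cod i j * cod i j - (p + p) * cod i j) + p * p)
      ≡⟨ 𝔼-cong (λ i → linear (λ j → cod i j * cod i j) (cod i)) ⟩
    𝔼 (λ i → (𝔼 (λ j → cod i j * cod i j) - (p + p) * 𝔼 (cod i)) + p * p)
      ≡⟨ linear (λ i → 𝔼 λ j → cod i j * cod i j) (λ i → 𝔼 (cod i)) ⟩
    (f - (p + p) * 𝔼 (λ i → 𝔼 (cod i))) + p * p
      ≡⟨ cong (λ z → (f - (p + p) * z) + p * p) (trans (𝔼-cong (λ i → sym (deg₂≡𝔼cod i))) 𝔼deg₂≡p) ⟩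
    (f - (p + p) * p) + p * p
      ≡⟨ cancel f p ⟩
    f - p * p ∎
    where
    open ≤-Reasoning
    expand : ∀ a b → (a - b) * (a - b) ≡ (a * a - (b + b) * a) + b * b
    expand = solve-∀ ℚ-ring
    cancel : ∀ a b → (a - (b + b) * b) + b * b ≡ a - b * b
    cancel = solve-∀ ℚ-ring
    linear : ∀ (g₁ g₂ : Fin n → ℚ) → 𝔼 (λ i → (g₁ i - (p + p) * g₂ i) + p * p) ≡ (𝔼 g₁ - (p + p) * 𝔼 g₂) + p * p
    linear g₁ g₂ = trans (𝔼-+ (λ i → g₁ i - (p + p) * g₂ i) (λ _ → p * p))
      (cong₂ _+_ (trans (𝔼-minus g₁ (λ i → (p + p) * g₂ i)) (cong (_-_ (𝔼 g₁)) (𝔼-*ˡ (p + p) g₂))) (𝔼-const (p * p)))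

  codegDeviation-triangle : ∀ μ → codegDeviation μ ≤ codegDeviation p + ∣ p - μ ∣
  codegDeviation-triangle μ = begin
    codegDeviation μ
      ≤⟨ 𝔼-mono-≤ (λ i → 𝔼-mono-≤ λ j → triangle (cod i j)) ⟩
    𝔼 (λ i → 𝔼 λ j → ∣ cod i j - p ∣ + ∣ p - μ ∣)
      ≡⟨ 𝔼-cong (λ i → trans (𝔼-+ (λ j → ∣ cod i j - p ∣) (λ _ → ∣ p - μ ∣)) (cong (_+_ (𝔼 λ j → ∣ cod i j - p ∣)) (𝔼-const ∣ p - μ ∣))) ⟩
    𝔼 (λ i → 𝔼 (λ j → ∣ cod i j - p ∣) + ∣ p - μ ∣)
      ≡⟨ trans (𝔼-+ (λ i → 𝔼 λ j → ∣ cod i j - p ∣) (λ _ → ∣ p - μ ∣)) (cong (_+_ (codegDeviation p)) (𝔼-const ∣ p - μ ∣)) ⟩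
    codegDeviation p + ∣ p - μ ∣ ∎
    where
    open ≤-Reasoning
    telescope : ∀ a b c → (a - b) + (b - c) ≡ a - c
    telescope = solve-∀ ℚ-ring
    triangle : ∀ a → ∣ a - μ ∣ ≤ ∣ a - p ∣ + ∣ p - μ ∣
    triangle a = subst (λ z → ∣ z ∣ ≤ ∣ a - p ∣ + ∣ p - μ ∣) (telescope a p μ) (∣p+q∣≤∣p∣+∣q∣ (a - p) (p - μ))

  qrSum≤ : qrSum G ≤ pow N 3 * codegDeviation (density G * density G)
  qrSum≤ = begin
    qrSum G
      ≤⟨ Σ-mono-≤ n (λ i → Σ-mono-≤ n λ j → pointwise i j) ⟩
    sumFinℚ n (λ i → sumFinℚ n λ j → pow N 1 * ∣ cod i j - σ² ∣)
      ≡⟨ Σ≡pow*𝔼 2 (λ i → Σ≡pow*𝔼 1 λ j → refl) ⟩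
    pow N 3 * codegDeviation σ² ∎
    where
    open ≤-Reasoning
    σ² : ℚ
    σ² = density G * density G
    rescale : ∀ N c σ² → (N * 1ℚ) * c - σ² * N ≡ (N * 1ℚ) * (c - σ²)
    rescale = solve-∀ ℚ-ring
    0≤N¹ : 0ℚ ≤ pow N 1
    0≤N¹ = pow-nonNeg 1 (0≤ℕtoℚ n)
    ∣codeg-σ²N∣≡ : ∀ i j → ∣ ℕtoℚ (codeg G i j) - σ² * N ∣ ≡ pow N 1 * ∣ cod i j - σ² ∣
    ∣codeg-σ²N∣≡ i j = begin-equality
      ∣ ℕtoℚ (codeg G i j) - σ² * N ∣         ≡⟨ cong (λ c → ∣ c - σ² * N ∣) (codeg≡ i j) ⟩
      ∣ pow N 1 * cod i j - σ² * N ∣          ≡⟨ cong ∣_∣ (rescale N (cod i j) σ²) ⟩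
      ∣ pow N 1 * (cod i j - σ²) ∣            ≡⟨ ∣p*q∣≡∣p∣*∣q∣ (pow N 1) (cod i j - σ²) ⟩
      ∣ pow N 1 ∣ * ∣ cod i j - σ² ∣           ≡⟨ cong (_* ∣ cod i j - σ² ∣) (0≤p⇒∣p∣≡p 0≤N¹) ⟩
      pow N 1 * ∣ cod i j - σ² ∣              ∎
    pointwise : ∀ i j → (if neq i j then ∣ ℕtoℚ (codeg G i j) - σ² * N ∣ else 0ℚ) ≤ pow N 1 * ∣ cod i j - σ² ∣
    pointwise i j with neq i j
    ... | true  = ≤-reflexive (∣codeg-σ²N∣≡ i j)
    ... | false = nonNeg-* 0≤N¹ (0≤∣p∣ (cod i j - σ²))

  qrSum-nonNeg : 0ℚ ≤ qrSum G
  qrSum-nonNeg = Σ-nonNeg n λ i → Σ-nonNeg n λ j → pointwise i j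
    where
    pointwise : ∀ i j → 0ℚ ≤ (if neq i j then ∣ ℕtoℚ (codeg G i j) - density G * density G * N ∣ else 0ℚ)
    pointwise i j with neq i j
    ... | true  = 0≤∣p∣ _
    ... | false = ≤-refl

-- σ = 2e(R)/(n(n-1)) and s = 2e(R)/n², so (σ - s)(n - 1) = s.
[density-s]*[n-1]≡s : ∀ {k} (G : RedBlueK (suc (suc k))) →
  (density G - RedGraph.s G) * ℕtoℚ (suc k) ≡ RedGraph.s G
[density-s]*[n-1]≡s {k} G = begin
  (σ - s) * M                              ≡⟨ *-identityˡ _ ⟨
  1ℚ * ((σ - s) * M)                       ≡⟨ cong (_* ((σ - s) * M)) (1/suc-inverseˡ (suc k)) ⟨
  (ν * N) * ((σ - s) * M)                  ≡⟨ distrib ν N σ s M ⟩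
  ν * (σ * (N * M)) - ν * N * (s * M)      ≡⟨ cong (λ z → ν * z - ν * N * (s * M)) σNM≡N²s ⟩
  ν * (N * (N * 1ℚ) * s) - ν * N * (s * M) ≡⟨ factor ν N s M ⟩
  (ν * N) * ((N - M) * s)                  ≡⟨ cong₂ (λ a b → a * ((b - M) * s)) (1/suc-inverseˡ (suc k)) (ℕtoℚ-+ 1 (suc k)) ⟩
  1ℚ * (((1ℚ + M) - M) * s)                ≡⟨ simplify M s ⟩
  s                                        ∎
  where
  open ≡-Reasoning
  open RedGraph G using (s; redOrdered≡)
  σ N M ν : ℚ
  σ = density G
  N = ℕtoℚ (suc (suc k))
  M = ℕtoℚ (suc k)
  ν = 1/suc (suc k)
  K : ℕ
  K = k ℕ.+ suc k ℕ.* suc k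
  σNM≡N²s : σ * (N * M) ≡ N * (N * 1ℚ) * s
  σNM≡N²s = begin
    σ * (N * M)                                        ≡⟨ cong₂ _*_ (/suc≡*1/suc (redOrdered G) K) (sym (ℕtoℚ-* (suc (suc k)) (suc k))) ⟩
    ℕtoℚ (redOrdered G) * 1/suc K * ℕtoℚ (suc K)       ≡⟨ *-assoc (ℕtoℚ (redOrdered G)) (1/suc K) (ℕtoℚ (suc K)) ⟩
    ℕtoℚ (redOrdered G) * (1/suc K * ℕtoℚ (suc K))     ≡⟨ cong (ℕtoℚ (redOrdered G) *_) (1/suc-inverseˡ K) ⟩
    ℕtoℚ (redOrdered G) * 1ℚ                           ≡⟨ *-identityʳ _ ⟩
    ℕtoℚ (redOrdered G)                                ≡⟨ redOrdered≡ ⟩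
    N * (N * 1ℚ) * s                                   ∎
  distrib : ∀ ν N σ s M → (ν * N) * ((σ - s) * M) ≡ ν * (σ * (N * M)) - ν * N * (s * M)
  distrib = solve-∀ ℚ-ring
  factor : ∀ ν N s M → ν * (N * (N * 1ℚ) * s) - ν * N * (s * M) ≡ (ν * N) * ((N - M) * s)
  factor = solve-∀ ℚ-ring
  simplify : ∀ M s → 1ℚ * (((1ℚ + M) - M) * s) ≡ s
  simplify = solve-∀ ℚ-ring

512*rrrb≤27n⁴ : ∀ n → n ℕ.≥ 1 → (G : RedBlueK n) → 512 ℕ.* rrrb G ℕ.≤ 27 ℕ.* n ℕ.^ 4
512*rrrb≤27n⁴ (suc k) _ G = ℕₚ.≤-trans 512⌊T/8⌋≤64T 64T≤27n⁴
  where
  open RedGraph G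
  tuples : ℕ
  tuples = rrrbTuples G
  N : ℚ
  N = ℕtoℚ (suc k)
  64T≤27n⁴ : 64 ℕ.* tuples ℕ.≤ 27 ℕ.* suc k ℕ.^ 4
  64T≤27n⁴ = ℕtoℚ-cancel-≤ (begin
    ℕtoℚ (64 ℕ.* tuples)                             ≡⟨ ℕtoℚ-* 64 tuples ⟩
    ℕtoℚ 64 * ℕtoℚ tuples                            ≤⟨ *-monoˡ-≤ (ℕtoℚ 64) (0≤ℕtoℚ 64) (≤-trans rrrbTuples≤ 4N⁴[x-f]≤) ⟩
    ℕtoℚ 64 * (pow N 4 * ((+ 4 / 1) * (+ 27 / 256))) ≡⟨ simplify (pow N 4) ⟩
    ℕtoℚ 27 * pow N 4                                ≡⟨ trans (ℕtoℚ-* 27 (suc k ℕ.^ 4)) (cong (ℕtoℚ 27 *_) (ℕtoℚ-^ (suc k) 4)) ⟨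
    ℕtoℚ (27 ℕ.* suc k ℕ.^ 4)                        ∎)
    where
    open ≤-Reasoning
    4N⁴[x-f]≤ : pow N 4 * ((+ 4 / 1) * (x - f)) ≤ pow N 4 * ((+ 4 / 1) * (+ 27 / 256))
    4N⁴[x-f]≤ = *-monoˡ-≤ (pow N 4) (pow-nonNeg 4 (0≤ℕtoℚ (suc k)))
                  (*-monoˡ-≤ (+ 4 / 1) (nonNeg-byComputation _) (x-f≤27/256 walkDensities))
    simplify : ∀ m → + 64 / 1 * (m * ((+ 4 / 1) * (+ 27 / 256))) ≡ + 27 / 1 * m
    simplify = solve-∀ ℚ-ring
  512⌊T/8⌋≤64T : 512 ℕ.* (tuples ℕ./ 8) ℕ.≤ 64 ℕ.* tuples
  512⌊T/8⌋≤64T = ℕₚ.≤-trans (ℕₚ.≤-reflexive (regroup (tuples ℕ./ 8))) (ℕₚ.*-monoʳ-≤ 64 (m/n*n≤m tuples 8))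
    where
    regroup : ∀ m → 512 ℕ.* m ≡ 64 ℕ.* (m ℕ.* 8)
    regroup m = trans (ℕₚ.*-assoc 64 8 m) (cong (64 ℕ.*_) (ℕₚ.*-comm 8 m))

near-extremal : ∀ {k} (G : RedBlueK (suc k)) {δ} →
  (+ 27 / 512) * ℕtoℚ (suc k ℕ.^ 4) - δ * ℕtoℚ (suc k ℕ.^ 4) < ℕtoℚ (rrrb G) →
  + 27 / 256 - (+ 2 / 1) * δ < RedGraph.x G - RedGraph.f G
near-extremal {k} G {δ} many = *-cancelˡ-<-nonNeg (pow N 4 * (+ 4 / 1)) {{nonNegative 0≤4N⁴}} (begin-strict
  pow N 4 * (+ 4 / 1) * (+ 27 / 256 - (+ 2 / 1) * δ)                ≡⟨ rescale (pow N 4) δ ⟩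
  (+ 8 / 1) * ((+ 27 / 512) * pow N 4 - δ * pow N 4)                ≡⟨ cong (λ m → (+ 8 / 1) * ((+ 27 / 512) * m - δ * m)) (ℕtoℚ-^ (suc k) 4) ⟨
  (+ 8 / 1) * ((+ 27 / 512) * ℕtoℚ (suc k ℕ.^ 4) - δ * ℕtoℚ (suc k ℕ.^ 4)) <⟨ *-monoʳ-<-pos (+ 8 / 1) many ⟩
  (+ 8 / 1) * ℕtoℚ (rrrb G)                                         ≡⟨ trans (ℕtoℚ-* (rrrb G) 8) (*-comm (ℕtoℚ (rrrb G)) (+ 8 / 1)) ⟨
  ℕtoℚ (rrrb G ℕ.* 8)                                               ≤⟨ ℕtoℚ-mono-≤ (m/n*n≤m (rrrbTuples G) 8) ⟩
  ℕtoℚ (rrrbTuples G)                                               ≤⟨ rrrbTuples≤ ⟩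
  pow N 4 * ((+ 4 / 1) * (x - f))                                   ≡⟨ *-assoc (pow N 4) (+ 4 / 1) (x - f) ⟨
  pow N 4 * (+ 4 / 1) * (x - f)                                     ∎)
  where
  open ≤-Reasoning
  open RedGraph G using (x; f; rrrbTuples≤)
  N : ℚ
  N = ℕtoℚ (suc k)
  0≤4N⁴ : 0ℚ ≤ pow N 4 * (+ 4 / 1)
  0≤4N⁴ = nonNeg-* (pow-nonNeg 4 (0≤ℕtoℚ (suc k))) (nonNeg-byComputation _)
  rescale : ∀ m δ → m * (+ 4 / 1) * (+ 27 / 256 - (+ 2 / 1) * δ) ≡ (+ 8 / 1) * ((+ 27 / 512) * m - δ * m)
  rescale = solve-∀ ℚ-ring

module _ {δ : ℚ} (0<δ : 0ℚ < δ) (δ<ε : δ < + 1 / 1000000) {k : ℕ} (↧δ≤k : ↧ₙ δ ℕ.≤ k)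
         (G : RedBlueK (suc (suc k)))
         (many : (+ 27 / 512) * ℕtoℚ (suc (suc k) ℕ.^ 4) - δ * ℕtoℚ (suc (suc k) ℕ.^ 4) < ℕtoℚ (rrrb G)) where

  open RedGraph G
  open WalkDensities walkDensities using (s∈[0,1])
  open NearExtremal walkDensities 0<δ δ<ε (near-extremal G {δ} many)

  private
    N σ : ℚ
    N = ℕtoℚ (suc (suc k))
    σ = density G
    0≤δ : 0ℚ ≤ δ
    0≤δ = <⇒≤ 0<δ

    0≤σ-s×σ-s≤δ : 0ℚ ≤ σ - s × σ - s ≤ δ
    0≤σ-s×σ-s≤δ = 0≤σ-s≤δ {σ} {s} {ℕtoℚ (suc k)} {δ} ([density-s]*[n-1]≡s G)
      (≤-trans (1≤↧δ*δ δ 0<δ) (*-monoʳ-≤ δ 0≤δ (ℕtoℚ-mono-≤ (ℕₚ.m≤n⇒m≤1+n ↧δ≤k))))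
      s∈[0,1] 0≤δ

    [density-3/4]²≤4370δ : (σ - + 3 / 4) * (σ - + 3 / 4) ≤ (+ 4370 / 1) * δ
    [density-3/4]²≤4370δ = [σ-3/4]²≤4370δ {σ} {s} {δ} [s-3/4]²≤2184δ (proj₁ 0≤σ-s×σ-s≤δ) (proj₂ 0≤σ-s×σ-s≤δ) δ*δ≤δ

  density-near-3/4 : LeRoot ∣ density G - + 3 / 4 ∣ (+ 4 / 1) 4 δ
  density-near-3/4 = inj₂ (0≤∣p∣ _ , ∣z∣⁴≤4⁴δ {σ - + 3 / 4} {δ} [density-3/4]²≤4370δ 0≤δ (<⇒≤ δ<ε))

  quasirandom : LtRoot (qrSum G) ((+ 4 / 1) * ℕtoℚ (suc (suc k) ℕ.^ 3)) 8 δ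
  quasirandom = inj₂ (qrSum-nonNeg , (begin-strict
    pow (qrSum G) 8                                 ≤⟨ pow-mono-≤ 8 qrSum-nonNeg qrSum≤N³z ⟩
    pow (pow N 3 * z) 8                             ≡⟨ pow-*-distrib (pow N 3) z 8 ⟩
    pow (pow N 3) 8 * pow z 8                       <⟨ *-monoʳ-<-pos (pow (pow N 3) 8) {{positive (pow-pos 8 (pow-pos 3 0<N))}}
                                                         ([w+∣p-σ²∣]⁸<4⁸δ {codegDeviation p} {p} {σ} {δ} (codegDeviation-nonNeg p)
                                                             (≤-trans codegDeviation[p]²≤f-p² f-p²≤52δ)
                                                             [p-9/16]²≤126δ [density-3/4]²≤4370δ 0<δ (<⇒≤ δ<ε)) ⟩
    pow (pow N 3) 8 * (pow (+ 4 / 1) 8 * δ)         ≡⟨ regroup (pow (pow N 3) 8) (pow (+ 4 / 1) 8) δ ⟩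
    pow (+ 4 / 1) 8 * pow (pow N 3) 8 * δ           ≡⟨ cong (_* δ) (pow-*-distrib (+ 4 / 1) (pow N 3) 8) ⟨
    pow ((+ 4 / 1) * pow N 3) 8 * δ                 ≡⟨ cong (λ m → pow ((+ 4 / 1) * m) 8 * δ) (ℕtoℚ-^ (suc (suc k)) 3) ⟨
    pow ((+ 4 / 1) * ℕtoℚ (suc (suc k) ℕ.^ 3)) 8 * δ ∎))
    where
    open ≤-Reasoning
    z : ℚ
    z = codegDeviation p + ∣ p - σ * σ ∣
    0<N : 0ℚ < N
    0<N = <-≤-trans (<-byComputation 0ℚ 1ℚ) (ℕtoℚ-mono-≤ {1} {suc (suc k)} (ℕ.s≤s ℕ.z≤n))
    qrSum≤N³z : qrSum G ≤ pow N 3 * z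
    qrSum≤N³z = ≤-trans qrSum≤ (*-monoˡ-≤ (pow N 3) (pow-nonNeg 3 (<⇒≤ 0<N)) (codegDeviation-triangle (σ * σ)))
    regroup : ∀ a b c → a * (b * c) ≡ b * a * c
    regroup = solve-∀ ℚ-ring

theorem1p9 :
    (Σ ℕ λ C → ∀ (n : ℕ) → n ≥ 1 → (G : RedBlueK n) →
       512 ℕ.* rrrb G ℕ.≤ 27 ℕ.* n ℕ.^ 4 ℕ.+ C ℕ.* n ℕ.^ 3)
    ×
    (∀ (δ : ℚ) → 0ℚ < δ → δ < + 1 / 1000000 →
       Σ ℕ λ n₀ → ∀ (n : ℕ) → n ≥ n₀ → (G : RedBlueK n) →
         (+ 27 / 512) * ℕtoℚ (n ℕ.^ 4) - δ * ℕtoℚ (n ℕ.^ 4) < ℕtoℚ (rrrb G) →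
         LeRoot ∣ density G - + 3 / 4 ∣ (+ 4 / 1) 4 δ
         × LtRoot (qrSum G) ((+ 4 / 1) * ℕtoℚ (n ℕ.^ 3)) 8 δ)
theorem1p9 = (0 , λ n n≥1 G → ℕₚ.≤-trans (512*rrrb≤27n⁴ n n≥1 G) (ℕₚ.m≤m+n _ _))
           , λ δ 0<δ δ<ε → suc (suc (↧ₙ δ)) , λ where
               -- n ≥ ↧δ + 2 makes (n - 1)δ ≥ 1, which keeps σ = sn/(n - 1) within δ of s.
               (suc (suc k)) (ℕ.s≤s (ℕ.s≤s ↧δ≤k)) G many →
                 density-near-3/4 0<δ δ<ε ↧δ≤k G many , quasirandom 0<δ δ<ε ↧δ≤k G many
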